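{- Let $d$ be a positive integer. For $n\ge0$ let $a_n(2^d)=m_1(\mathrm{Im}\mathcal P_2(n,2^d))$ and $Q_n(2^d)=|\mathcal Q(n,2^d)|$. Then: (a) $\displaystyle\sum_{n\ge0}a_n(2^d)q^n=q^2\prod_{i\ge0}(1+q^{2^i})^{\lfloor i/d\rfloor+3}$. (b) For $n\ge0$, $a_{n+2}(2^d)=Q_n(2^d)$. (c) For $n\ge0$, $\displaystyle a_{n+2}(2^d)=\sum_{\lambda\in\mathcal B(n)}\prod_{i\ge0}\binom{\lfloor i/d\rfloor+3}{m_{2^i}(\lambda)}$.
   Context: For an integer $D\ge2$, a $D$-ary partition is a partition (weakly decreasing sequence of positive integers) all of whose parts are powers of $D$ (including $1$). $\mathcal P_2(n,D)$ is the set of $D$-ary partitions of $n$ with at least two parts. For $\lambda=(\lambda_1,\dots,\lambda_\ell)$ with $\ell\ge2$, $\mathrm{pre}_2(\lambda)$ is the partition whose parts are the products $\lambda_i\lambda_j$, $1\le i<j\le\ell$; $\mathrm{Im}\mathcal P_2(n,D)=\{\mathrm{pre}_2(\lambda):\lambda\in\mathcal P_2(n,D)\}$. $m_i(\mu)$ is the number of parts of $\mu$ equal to $i$, and $m_i(S)=\sum_{\mu\in S}m_i(\mu)$ for a set $S$ of partitions. $\mathcal B(n)$ is the set of binary ($2$-ary) partitions of $n$. $\mathcal Q(m,2^d)$ is the set of color binary partitions of $m$ into distinct parts in which a part of size $2^t$ ($t\ge0$) can come in $\lfloor t/d\rfloor+3$ different colors $2^t_1,\dots,2^t_{\lfloor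 t/d\rfloor+3}$; i.e. sets of distinct colored parts whose sizes sum to $m$. -}

module Defs where

open import Data.Nat using (ℕ; zero; suc; _+_; _*_; _∸_; _^_; _≤_; _<_; _≥_; _>_; NonZero)
open import Data.Nat.Properties using (_≟_)
open import Data.Nat.DivMod using (_/_)
open import Data.Nat.Combinatorics using (_C_)
open import Data.Nat.ListAction using (sum)
open import Data.List using (List; []; _∷_; map; length; filter; upTo; _++_; foldr)
open import Data.List.Relation.Unary.All using (All)
open import Data.List.Relation.Unary.Linked using (Linked)
open import Data.List.Relation.Unary.Unique.Propositional using (Unique)
open import Data.List.Membership.Propositional using (_∈_)
open import Data.List.Relation.Binary.Permutation.Propositional using (_↭_)
open import Data.Product using (_×_; ∃; ∃-syntax)
open import Data.Sum using (_⊎_)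
open import Relation.Binary.PropositionalEquality using (_≡_)
open import Relation.Nullary using (does)
open import Data.Bool using (if_then_else_)
open import Function.Bundles using (_⇔_)

Partition : Set
Partition = List ℕ

IsPartitionOf : ℕ → Partition → Set
IsPartitionOf n λ′ = Linked _≥_ λ′ × All (λ x → 0 < x) λ′ × sum λ′ ≡ n

IsPowerOf : ℕ → ℕ → Set
IsPowerOf D k = ∃[ j ] k ≡ D ^ j

P₂ : ℕ → ℕ → Partition → Set
P₂ n D λ′ = IsPartitionOf n λ′ × All (IsPowerOf D) λ′ × 2 ≤ length λ′

pairProducts : List ℕ → List ℕ
pairProducts []       = []
pairProducts (x ∷ xs) = map (x *_) xs ++ pairProducts xs

-- Im P_2(n, D): μ is (the weakly decreasing arrangement of) pre_2(λ)
-- for some λ ∈ P_2(n, D)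
ImP₂ : ℕ → ℕ → Partition → Set
ImP₂ n D μ = Linked _≥_ μ × ∃[ λ′ ] (P₂ n D λ′ × μ ↭ pairProducts λ′)

mult : ℕ → Partition → ℕ
mult i μ = length (filter (i ≟_) μ)

B : ℕ → Partition → Set
B n λ′ = IsPartitionOf n λ′ × All (IsPowerOf 2) λ′

record Enumeration {A : Set} (P : A → Set) : Set where
  field
    elems    : List A
    unique   : Unique elems
    complete : ∀ x → (x ∈ elems ⇔ P x)
open Enumeration public

-- Q(m, 2^d): a coloured part is (t , c) meaning 2^t with colour c,
-- c ∈ {0, …, ⌊t/d⌋+2} (i.e. ⌊t/d⌋+3 colours).  A set of distinct coloured
-- parts is represented canonically as a strictly decreasing list w.r.t.
-- the lexicographic order on (t , c).

ColouredPart : Set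
ColouredPart = ℕ × ℕ

open import Data.Product using (_,_; proj₁)

nColours : (d : ℕ) → .{{NonZero d}} → ℕ → ℕ
nColours d t = t / d + 3

ValidColour : (d : ℕ) → .{{NonZero d}} → ColouredPart → Set
ValidColour d (t , c) = c < nColours d t

_>ₗ_ : ColouredPart → ColouredPart → Set
(t , c) >ₗ (t′ , c′) = t > t′ ⊎ (t ≡ t′ × c > c′)

partSize : ColouredPart → ℕ
partSize (t , c) = 2 ^ t

Q : (d : ℕ) → .{{NonZero d}} → ℕ → List ColouredPart → Set
Q d m s = Linked _>ₗ_ s × All (ValidColour d) s × sum (map partSize s) ≡ m

PS : Set
PS = ℕ → ℕ

qPow : ℕ → PS
qPow e n = if does (n ≟ e) then 1 else 0

oneS : PS
oneS = qPow 0

_⊕_ : PS → PS → PS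
(f ⊕ g) n = f n + g n

_⊛_ : PS → PS → PS
(f ⊛ g) n = sum (map (λ k → f k * g (n ∸ k)) (upTo (suc n)))

powS : PS → ℕ → PS
powS f zero    = oneS
powS f (suc k) = f ⊛ powS f k

prodS : ℕ → (ℕ → PS) → PS
prodS zero    F = oneS
prodS (suc N) F = prodS N F ⊛ F N

factor : (d : ℕ) → .{{NonZero d}} → ℕ → PS
factor d i = powS (oneS ⊕ qPow (2 ^ i)) (nColours d i)

partialRHS : (d : ℕ) → .{{NonZero d}} → ℕ → PS
partialRHS d N = qPow 2 ⊛ prodS N (factor d)

-- ∏_{i ≥ 0} binom(⌊i/d⌋+3, m_{2^i}(λ)); factors with 2^i > n (in
-- particular all i > n, since λ ⊢ n) equal binom(_,0) = 1, so the
-- product is taken over i ≤ n.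
binomProd : (d : ℕ) → .{{NonZero d}} → ℕ → Partition → ℕ
binomProd d n λ′ = foldr _*_ 1 (map (λ i → nColours d i C mult (2 ^ i) λ′) (upTo (suc n)))

{-# OPTIONS --safe #-}

-- A part 1 of pre₂ λ is a product of two parts 1 of λ, so m₁(pre₂ λ) = binom(m₁(λ), 2), and pre₂ is
-- injective on partitions having a part 1: the least product involving a further part is that part
-- itself. Hence ∑ aₙ qⁿ = ∑ binom(m₁(λ), 2) q^|λ| over the D-ary partitions λ, which factors as
-- q²/(1-q)³ · ∏_{j ≥ 1} 1/(1-q^(D^j)). Expanding 1/(1-q^(2^s)) = ∏_{i ≥ s} (1+q^(2^i)) for s = 0
-- (three times) and for s = dj gives ∏_i (1+q^(2^i))^(⌊i/d⌋+3). Parts (b) and (c) read the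
-- coefficients of this product in two ways: as sets of coloured parts, and as binary partitions
-- weighted by binomial coefficients. All identities are proved coefficientwise, truncating the
-- infinite products beyond the coefficient considered.

module Submission where

open import Defs
open import Level using (0ℓ)
open import Function using (_∘_; id)
open import Function.Bundles using (mk⇔; Equivalence)
open import Data.Empty using (⊥-elim)
open import Data.Unit using (tt)
open import Data.Bool using (true; false; if_then_else_; T)
open import Data.Product using (_,_; _×_; proj₁; proj₂; ∃-syntax)
open import Data.Sum using (_⊎_; inj₁; inj₂; map₂)
open import Data.Fin using (zero; suc)
open import Data.Vec using ([]; _∷_)
open import Relation.Nullary using (yes; no; ¬_; does)
open import Relation.Nullary.Decidable using (dec-true; dec-false)
open import Relation.Unary using (Decidable)
open import Relation.Binary.Core using (Rel)
open import Relation.Binary.Bundles using (Setoid)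
open import Relation.Binary.Definitions using (Transitive; tri<; tri≈; tri>)
open import Relation.Binary.PropositionalEquality hiding ([_])
import Relation.Binary.Construct.Flip.EqAndOrd as Flip
open import Algebra.Bundles using (CommutativeMonoid)
import Algebra.Solver.CommutativeMonoid as CommutativeMonoidSolver

open import Data.Nat
open import Data.Nat.Properties
open import Data.Nat.DivMod using (_/_; m*n/n≡m; /-monoˡ-≤; m/n*n≤m; m/n≤m)
open import Data.Nat.Combinatorics using (_C_; nCk+nC[k+1]≡[n+1]C[k+1]; k>n⇒nCk≡0; nC1≡n)
open import Data.Nat.Solver using (module +-*-Solver)
open +-*-Solver using (solve; _:+_; _:*_; _:=_)
open import Algebra.Properties.CommutativeSemigroup *-commutativeSemigroup using (x∙yz≈y∙xz)

open import Data.List using (List; []; _∷_; map; applyUpTo; upTo; downFrom; _++_; replicate; concatMap; filter; length; foldr; [_])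
open import Data.List.Properties
  using (map-applyUpTo; map-++; map-∘; map-cong; map-replicate; ++-cancelˡ; ∷-injective; ∷-injectiveʳ; ++-assoc; ++-identityʳ;
         length-++; filter-++; filter-none; filter-accept)
open import Data.Nat.ListAction using (sum)
open import Data.Nat.ListAction.Properties using (sum-++; sum-↭)
import Data.List.Sort as Sort
open import Data.List.Membership.Propositional using (_∈_; find; lose)
open import Data.List.Membership.Propositional.Properties
  using (∈-map⁺; ∈-map⁻; ∈-++⁺ˡ; ∈-++⁺ʳ; ∈-++⁻; ∈-concatMap⁺; ∈-concatMap⁻; ∈-upTo⁺; ∈-downFrom⁺; ∈-downFrom⁻;
         ∈-filter⁺; ∈-filter⁻)
open import Data.List.Membership.Propositional.Properties.WithK using (unique∧set⇒bag)
open import Data.List.Relation.Unary.Any using (here; there)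
open import Data.List.Relation.Unary.All as All using (All; []; _∷_; lookup; tabulate)
import Data.List.Relation.Unary.All.Properties as All
open import Data.List.Relation.Unary.AllPairs as AllPairs using ([]; _∷_)
import Data.List.Relation.Unary.AllPairs.Properties as AllPairs
open import Data.List.Relation.Unary.Linked as Linked using (Linked; []; [-]; _∷_)
open import Data.List.Relation.Unary.Linked.Properties using (Linked⇒All)
open import Data.List.Relation.Unary.Unique.Propositional using (Unique)
import Data.List.Relation.Unary.Unique.Propositional.Properties as Unique
open import Data.List.Relation.Unary.Sorted.TotalOrder.Properties using (↗↭↗⇒≋)
open import Data.List.Relation.Binary.Disjoint.Propositional using (Disjoint)
open import Data.List.Relation.Binary.Equality.Propositional using (≋⇒≡)
open import Data.List.Relation.Binary.BagAndSetEquality using (∼bag⇒↭)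
open import Data.List.Relation.Binary.Permutation.Propositional as Perm using (_↭_; ↭-sym; ↭-trans; ↭⇒↭ₛ)
import Data.List.Relation.Binary.Permutation.Propositional.Properties as ↭

-- Formal power series

∑< : ℕ → (ℕ → ℕ) → ℕ
∑< n f = sum (applyUpTo f n)

∑<-cong : ∀ n {f g} → (∀ k → k < n → f k ≡ g k) → ∑< n f ≡ ∑< n g
∑<-cong zero f≡g = refl
∑<-cong (suc n) f≡g = cong₂ _+_ (f≡g 0 z<s) (∑<-cong n (λ k k<n → f≡g (suc k) (s<s k<n)))

∑<-vanishing : ∀ n f → (∀ k → k < n → f k ≡ 0) → ∑< n f ≡ 0
∑<-vanishing zero f f≡0 = refl
∑<-vanishing (suc n) f f≡0 = cong₂ _+_ (f≡0 0 z<s) (∑<-vanishing n (f ∘ suc) (λ k k<n → f≡0 (suc k) (s<s k<n)))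

∑<-distrib-+ : ∀ n f g → ∑< n (λ k → f k + g k) ≡ ∑< n f + ∑< n g
∑<-distrib-+ zero f g = refl
∑<-distrib-+ (suc n) f g = trans (cong (f 0 + g 0 +_) (∑<-distrib-+ n (f ∘ suc) (g ∘ suc)))
  (solve 4 (λ a b c d → (a :+ b) :+ (c :+ d) := (a :+ c) :+ (b :+ d)) refl
    (f 0) (g 0) (∑< n (f ∘ suc)) (∑< n (g ∘ suc)))

∑<-*ˡ : ∀ n c f → ∑< n (λ k → c * f k) ≡ c * ∑< n f
∑<-*ˡ zero c f = sym (*-zeroʳ c)
∑<-*ˡ (suc n) c f = trans (cong (c * f 0 +_) (∑<-*ˡ n c (f ∘ suc))) (sym (*-distribˡ-+ c (f 0) _))

∑<-extend : ∀ n m f → n ≤ m → (∀ k → n ≤ k → f k ≡ 0) → ∑< m f ≡ ∑< n f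
∑<-extend zero m f _ f≡0 = ∑<-vanishing m f (λ k _ → f≡0 k z≤n)
∑<-extend (suc n) (suc m) f (s≤s n≤m) f≡0 =
  cong (f 0 +_) (∑<-extend n m (f ∘ suc) n≤m (λ k n≤k → f≡0 (suc k) (s≤s n≤k)))

∑<-last : ∀ n f → ∑< (suc n) f ≡ ∑< n f + f n
∑<-last zero f = +-identityʳ (f 0)
∑<-last (suc n) f = trans (cong (f 0 +_) (∑<-last n (f ∘ suc))) (sym (+-assoc (f 0) _ _))

∑<-reverse : ∀ n f → ∑< n f ≡ ∑< n (λ k → f (n ∸ suc k))
∑<-reverse zero f = refl
∑<-reverse (suc n) f = begin
    f 0 + ∑< n (f ∘ suc)
  ≡⟨ cong (f 0 +_) (∑<-reverse n (f ∘ suc)) ⟩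
    f 0 + ∑< n (λ k → f (suc (n ∸ suc k)))
  ≡⟨ cong (f 0 +_) (∑<-cong n (λ k k<n → cong f (sym (+-∸-assoc 1 k<n)))) ⟩
    f 0 + ∑< n (λ k → f (n ∸ k))
  ≡⟨ +-comm (f 0) _ ⟩
    ∑< n (λ k → f (n ∸ k)) + f 0
  ≡⟨ cong (λ z → ∑< n (λ k → f (n ∸ k)) + f z) (sym (n∸n≡0 n)) ⟩
    ∑< n (λ k → f (n ∸ k)) + f (n ∸ n)
  ≡⟨ sym (∑<-last n (λ k → f (n ∸ k))) ⟩
    ∑< (suc n) (λ k → f (n ∸ k))
  ∎ where open ≡-Reasoning

open Setoid (ℕ →-setoid ℕ) using () renaming (refl to ≗-refl; sym to ≗-sym; trans to ≗-trans; reflexive to ≡⇒≗)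

infix 4 _≗[≤_]_

_≗[≤_]_ : PS → ℕ → PS → Set
f ≗[≤ n ] g = ∀ k → k ≤ n → f k ≡ g k

≗⇒≗[≤] : ∀ {f g} n → f ≗ g → f ≗[≤ n ] g
≗⇒≗[≤] n f≗g k _ = f≗g k

≗[≤]-trans : ∀ {f g h} n → f ≗[≤ n ] g → g ≗[≤ n ] h → f ≗[≤ n ] h
≗[≤]-trans n f≗g g≗h k k≤n = trans (f≗g k k≤n) (g≗h k k≤n)

⊛-as-∑ : ∀ f g n → (f ⊛ g) n ≡ ∑< (suc n) (λ k → f k * g (n ∸ k))
⊛-as-∑ f g n = cong sum (map-applyUpTo id (λ k → f k * g (n ∸ k)) (suc n))

⊛-at-0 : ∀ f g → (f ⊛ g) 0 ≡ f 0 * g 0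
⊛-at-0 f g = +-identityʳ _

⊛-at-suc : ∀ f g n → (f ⊛ g) (suc n) ≡ f 0 * g (suc n) + ((f ∘ suc) ⊛ g) n
⊛-at-suc f g n = trans (⊛-as-∑ f g (suc n)) (cong (f 0 * g (suc n) +_) (sym (⊛-as-∑ (f ∘ suc) g n)))

⊛-coeff-cong : ∀ n {f f′ g g′} → f ≗[≤ n ] f′ → g ≗[≤ n ] g′ → (f ⊛ g) n ≡ (f′ ⊛ g′) n
⊛-coeff-cong n {f} {f′} {g} {g′} f≗f′ g≗g′ = trans (⊛-as-∑ f g n) (trans
  (∑<-cong (suc n) (λ k k<n → cong₂ _*_ (f≗f′ k (s≤s⁻¹ k<n)) (g≗g′ (n ∸ k) (m∸n≤m n k))))
  (sym (⊛-as-∑ f′ g′ n)))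

⊛-cong-≤ : ∀ n {f f′ g g′} → f ≗[≤ n ] f′ → g ≗[≤ n ] g′ → f ⊛ g ≗[≤ n ] f′ ⊛ g′
⊛-cong-≤ n f≗f′ g≗g′ k k≤n =
  ⊛-coeff-cong k (λ j j≤k → f≗f′ j (≤-trans j≤k k≤n)) (λ j j≤k → g≗g′ j (≤-trans j≤k k≤n))

⊛-cong : ∀ {f f′ g g′} → f ≗ f′ → g ≗ g′ → f ⊛ g ≗ f′ ⊛ g′
⊛-cong f≗f′ g≗g′ n = ⊛-coeff-cong n (≗⇒≗[≤] n f≗f′) (≗⇒≗[≤] n g≗g′)

⊛-identityʳ : ∀ f → f ⊛ oneS ≗ f
⊛-identityʳ f zero = trans (⊛-at-0 f oneS) (*-identityʳ (f 0))
⊛-identityʳ f (suc n) = trans (⊛-at-suc f oneS n) (cong₂ _+_ (*-zeroʳ (f 0)) (⊛-identityʳ (f ∘ suc) n))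

⊛-identityˡ : ∀ f → oneS ⊛ f ≗ f
⊛-identityˡ f zero = trans (⊛-at-0 oneS f) (+-identityʳ (f 0))
⊛-identityˡ f (suc n) = trans (⊛-at-suc oneS f n)
  (trans (cong (f (suc n) + 0 +_) (trans (⊛-as-∑ (λ _ → 0) f n) (∑<-vanishing (suc n) _ (λ _ _ → refl))))
    (trans (+-identityʳ _) (+-identityʳ _)))

⊛-distribʳ-⊕ : ∀ f g h → (f ⊕ g) ⊛ h ≗ (f ⊛ h) ⊕ (g ⊛ h)
⊛-distribʳ-⊕ f g h n = trans (⊛-as-∑ (f ⊕ g) h n) (trans
  (trans (∑<-cong (suc n) (λ k _ → *-distribʳ-+ (h (n ∸ k)) (f k) (g k)))
         (∑<-distrib-+ (suc n) (λ k → f k * h (n ∸ k)) (λ k → g k * h (n ∸ k))))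
  (sym (cong₂ _+_ (⊛-as-∑ f h n) (⊛-as-∑ g h n))))

⊛-scaleˡ : ∀ c f h n → ((λ k → c * f k) ⊛ h) n ≡ c * (f ⊛ h) n
⊛-scaleˡ c f h n = trans (⊛-as-∑ (λ k → c * f k) h n) (trans
  (trans (∑<-cong (suc n) (λ k _ → *-assoc c (f k) (h (n ∸ k)))) (∑<-*ˡ (suc n) c (λ k → f k * h (n ∸ k))))
  (cong (c *_) (sym (⊛-as-∑ f h n))))

⊛-comm : ∀ f g → f ⊛ g ≗ g ⊛ f
⊛-comm f g n = begin
    (f ⊛ g) n
  ≡⟨ ⊛-as-∑ f g n ⟩
    ∑< (suc n) (λ k → f k * g (n ∸ k))
  ≡⟨ ∑<-reverse (suc n) (λ k → f k * g (n ∸ k)) ⟩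
    ∑< (suc n) (λ k → f (n ∸ k) * g (n ∸ (n ∸ k)))
  ≡⟨ ∑<-cong (suc n) (λ k k<n → trans (cong (λ z → f (n ∸ k) * g z) (m∸[m∸n]≡n (s≤s⁻¹ k<n)))
                                      (*-comm (f (n ∸ k)) (g k))) ⟩
    ∑< (suc n) (λ k → g k * f (n ∸ k))
  ≡⟨ sym (⊛-as-∑ g f n) ⟩
    (g ⊛ f) n
  ∎ where open ≡-Reasoning

⊛-assoc : ∀ f g h → (f ⊛ g) ⊛ h ≗ f ⊛ (g ⊛ h)
⊛-assoc f g h zero = begin
    ((f ⊛ g) ⊛ h) 0
  ≡⟨ trans (⊛-at-0 (f ⊛ g) h) (cong (_* h 0) (⊛-at-0 f g)) ⟩
    f 0 * g 0 * h 0
  ≡⟨ *-assoc (f 0) (g 0) (h 0) ⟩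
    f 0 * (g 0 * h 0)
  ≡⟨ sym (trans (⊛-at-0 f (g ⊛ h)) (cong (f 0 *_) (⊛-at-0 g h))) ⟩
    (f ⊛ (g ⊛ h)) 0
  ∎ where open ≡-Reasoning
⊛-assoc f g h (suc n) = begin
    ((f ⊛ g) ⊛ h) (suc n)
  ≡⟨ ⊛-at-suc (f ⊛ g) h n ⟩
    (f ⊛ g) 0 * h (suc n) + (((f ⊛ g) ∘ suc) ⊛ h) n
  ≡⟨ cong₂ _+_ (cong (_* h (suc n)) (⊛-at-0 f g)) (⊛-cong (⊛-at-suc f g) (≗-refl {h}) n) ⟩
    f 0 * g 0 * h (suc n) + ((f₀g′ ⊕ (f′ ⊛ g)) ⊛ h) n
  ≡⟨ cong (f 0 * g 0 * h (suc n) +_) (⊛-distribʳ-⊕ f₀g′ (f′ ⊛ g) h n) ⟩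
    f 0 * g 0 * h (suc n) + ((f₀g′ ⊛ h) n + ((f′ ⊛ g) ⊛ h) n)
  ≡⟨ cong (f 0 * g 0 * h (suc n) +_) (cong₂ _+_ (⊛-scaleˡ (f 0) (g ∘ suc) h n) (⊛-assoc f′ g h n)) ⟩
    f 0 * g 0 * h (suc n) + (f 0 * ((g ∘ suc) ⊛ h) n + (f′ ⊛ (g ⊛ h)) n)
  ≡⟨ solve 5 (λ a b c d e → a :* b :* c :+ (a :* d :+ e) := a :* (b :* c :+ d) :+ e) refl
       (f 0) (g 0) (h (suc n)) (((g ∘ suc) ⊛ h) n) ((f′ ⊛ (g ⊛ h)) n) ⟩
    f 0 * (g 0 * h (suc n) + ((g ∘ suc) ⊛ h) n) + (f′ ⊛ (g ⊛ h)) n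
  ≡⟨ cong (λ z → f 0 * z + (f′ ⊛ (g ⊛ h)) n) (sym (⊛-at-suc g h n)) ⟩
    f 0 * (g ⊛ h) (suc n) + (f′ ⊛ (g ⊛ h)) n
  ≡⟨ sym (⊛-at-suc f (g ⊛ h) n) ⟩
    (f ⊛ (g ⊛ h)) (suc n)
  ∎ where
    open ≡-Reasoning
    f′ f₀g′ : PS
    f′ = f ∘ suc
    f₀g′ k = f 0 * g (suc k)

⊛-commutativeMonoid : CommutativeMonoid _ _
⊛-commutativeMonoid = record
  { Carrier = PS ; _≈_ = _≗_ ; _∙_ = _⊛_ ; ε = oneS
  ; isCommutativeMonoid = record
    { isMonoid = record
      { isSemigroup = record
        { isMagma = record { isEquivalence = Setoid.isEquivalence (ℕ →-setoid ℕ) ; ∙-cong = ⊛-cong }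
        ; assoc = ⊛-assoc }
      ; identity = ⊛-identityˡ , ⊛-identityʳ }
    ; comm = ⊛-comm } }

open CommutativeMonoidSolver ⊛-commutativeMonoid using (Expr; prove; var) renaming (id to ε; _⊕_ to _⊙_)

prodS-⊛ : ∀ K F G → prodS K (λ j → F j ⊛ G j) ≗ prodS K F ⊛ prodS K G
prodS-⊛ zero F G = ≗-sym (⊛-identityˡ oneS)
prodS-⊛ (suc K) F G = ≗-trans (⊛-cong (prodS-⊛ K F G) (≗-refl {F K ⊛ G K}))
  (prove 4 ((x ⊙ y) ⊙ (z ⊙ w)) ((x ⊙ z) ⊙ (y ⊙ w)) (prodS K F ∷ prodS K G ∷ F K ∷ G K ∷ []))
  where
  x y z w : Expr 4
  x = var zero ; y = var (suc zero) ; z = var (suc (suc zero)) ; w = var (suc (suc (suc zero)))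

prodS-oneS : ∀ K → prodS K (λ _ → oneS) ≗ oneS
prodS-oneS zero = ≗-refl
prodS-oneS (suc K) = ≗-trans (⊛-identityʳ _) (prodS-oneS K)

powS-+ : ∀ f a b → powS f (a + b) ≗ powS f a ⊛ powS f b
powS-+ f zero b = ≗-sym (⊛-identityˡ (powS f b))
powS-+ f (suc a) b = ≗-trans (⊛-cong (≗-refl {f}) (powS-+ f a b)) (≗-sym (⊛-assoc f (powS f a) (powS f b)))

infixr 7 [_≤_]·_

opaque
  [_≤_]·_ : ℕ → ℕ → ℕ → ℕ
  [ a ≤ m ]· v = if a ≤ᵇ m then v else 0

  [≤]·-holds : ∀ {a m} v → a ≤ m → [ a ≤ m ]· v ≡ v
  [≤]·-holds {a} {m} v a≤m with a ≤ᵇ m | ≤⇒≤ᵇ a≤m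
  ... | true | _ = refl

  [≤]·-fails : ∀ {a m} v → m < a → [ a ≤ m ]· v ≡ 0
  [≤]·-fails {a} {m} v m<a with a ≤ᵇ m in eq
  ... | false = refl
  ... | true = ⊥-elim (<⇒≱ m<a (≤ᵇ⇒≤ a m (subst T (sym eq) tt)))

  [≤]·-distrib-+ : ∀ a m u v → [ a ≤ m ]· (u + v) ≡ [ a ≤ m ]· u + [ a ≤ m ]· v
  [≤]·-distrib-+ a m u v with a ≤ᵇ m
  ... | true = refl
  ... | false = refl

  [≤]·-zero : ∀ a m → [ a ≤ m ]· 0 ≡ 0
  [≤]·-zero a m with a ≤ᵇ m
  ... | true = refl
  ... | false = refl

[≤]·-cong : ∀ a m {u v} → (a ≤ m → u ≡ v) → [ a ≤ m ]· u ≡ [ a ≤ m ]· v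
[≤]·-cong a m {u} {v} u≡v with a ≤? m
... | yes a≤m = trans ([≤]·-holds u a≤m) (trans (u≡v a≤m) (sym ([≤]·-holds v a≤m)))
... | no a≰m = trans ([≤]·-fails u (≰⇒> a≰m)) (sym ([≤]·-fails v (≰⇒> a≰m)))

[0≤]· : ∀ m v → [ 0 ≤ m ]· v ≡ v
[0≤]· m v = [≤]·-holds v z≤n

[≤]·-suc : ∀ a m v → [ suc a ≤ suc m ]· v ≡ [ a ≤ m ]· v
[≤]·-suc a m v with a ≤? m
... | yes a≤m = trans ([≤]·-holds v (s≤s a≤m)) (sym ([≤]·-holds v a≤m))
... | no a≰m = trans ([≤]·-fails v (s≤s (≰⇒> a≰m))) (sym ([≤]·-fails v (≰⇒> a≰m)))

qPow-⊛ : ∀ e X n → (qPow e ⊛ X) n ≡ [ e ≤ n ]· X (n ∸ e)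
qPow-⊛ zero X n = trans (⊛-identityˡ X n) (sym ([0≤]· n (X n)))
qPow-⊛ (suc e) X zero = trans (⊛-at-0 (qPow (suc e)) X) (sym ([≤]·-fails _ z<s))
qPow-⊛ (suc e) X (suc n) = trans (⊛-at-suc (qPow (suc e)) X n) (trans (qPow-⊛ e X n) (sym ([≤]·-suc e n _)))

qPow-+ : ∀ w k n → qPow n (w + k) ≡ [ w ≤ n ]· qPow (n ∸ w) k
qPow-+ zero k n = sym ([0≤]· n _)
qPow-+ (suc w) k zero = sym ([≤]·-fails _ z<s)
qPow-+ (suc w) k (suc n) = trans (qPow-+ w k n) (sym ([≤]·-suc w n _))

1+q^ : ℕ → PS
1+q^ a = oneS ⊕ qPow a

1+q^-⊛ : ∀ a Y n → (1+q^ a ⊛ Y) n ≡ Y n + [ a ≤ n ]· Y (n ∸ a)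
1+q^-⊛ a Y n = trans (⊛-distribʳ-⊕ oneS (qPow a) Y n) (cong₂ _+_ (⊛-identityˡ Y n) (qPow-⊛ a Y n))

-- the coefficient of q^m in (∑ₑ h e q^(e a)) X
dilated⊛ : (ℕ → ℕ) → ℕ → PS → PS
dilated⊛ h a X m = ∑< (suc m) (λ e → [ e * a ≤ m ]· (h e * X (m ∸ e * a)))

dilate : (ℕ → ℕ) → ℕ → PS
dilate h a = dilated⊛ h a oneS

dilated⊛-rec : ∀ h a X m → 1 ≤ a →
               dilated⊛ h a X m ≡ h 0 * X m + [ a ≤ m ]· dilated⊛ (h ∘ suc) a X (m ∸ a)
dilated⊛-rec h a X m 1≤a with a ≤? m
... | no a≰m = cong₂ _+_ ([0≤]· m (h 0 * X m)) (trans
      (∑<-vanishing m _ (λ e _ → [≤]·-fails _ (<-≤-trans (≰⇒> a≰m) (m≤m+n a (e * a)))))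
      (sym ([≤]·-fails _ (≰⇒> a≰m))))
... | yes a≤m = cong₂ _+_ ([0≤]· m (h 0 * X m)) (trans tail (sym ([≤]·-holds _ a≤m)))
  where
  r : ℕ
  r = m ∸ a
  m≡a+r : m ≡ a + r
  m≡a+r = sym (m+[n∸m]≡n a≤m)
  shifted : ∀ e → [ suc e * a ≤ m ]· (h (suc e) * X (m ∸ suc e * a)) ≡ [ e * a ≤ r ]· (h (suc e) * X (r ∸ e * a))
  shifted e with e * a ≤? r
  ... | yes ea≤r = trans ([≤]·-holds _ (subst (a + e * a ≤_) (sym m≡a+r) (+-monoʳ-≤ a ea≤r)))
                     (trans (cong (λ z → h (suc e) * X z) (sym (∸-+-assoc m a (e * a))))
                       (sym ([≤]·-holds _ ea≤r)))
  ... | no ea≰r = trans ([≤]·-fails _ (subst (_< a + e * a) (sym m≡a+r) (+-monoʳ-< a (≰⇒> ea≰r))))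
                    (sym ([≤]·-fails _ (≰⇒> ea≰r)))
  tail : ∑< m (λ e → [ suc e * a ≤ m ]· (h (suc e) * X (m ∸ suc e * a))) ≡ dilated⊛ (h ∘ suc) a X r
  tail = trans (∑<-cong m (λ e _ → shifted e))
    (∑<-extend (suc r) m _ (subst (suc r ≤_) (sym m≡a+r) (+-monoˡ-≤ r 1≤a))
      (λ k r<k → [≤]·-fails _ (<-≤-trans r<k (m≤m*n k a {{>-nonZero 1≤a}}))))

dilated⊛-cong : ∀ {h h′} a {X X′} → h ≗ h′ → X ≗ X′ → dilated⊛ h a X ≗ dilated⊛ h′ a X′
dilated⊛-cong a h≗h′ X≗X′ m =
  ∑<-cong (suc m) (λ e _ → cong ([ e * a ≤ m ]·_) (cong₂ _*_ (h≗h′ e) (X≗X′ (m ∸ e * a))))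

dilated⊛-distrib-+ : ∀ h h′ a X m → dilated⊛ (λ e → h e + h′ e) a X m ≡ dilated⊛ h a X m + dilated⊛ h′ a X m
dilated⊛-distrib-+ h h′ a X m = trans
  (∑<-cong (suc m) (λ e _ → trans (cong ([ e * a ≤ m ]·_) (*-distribʳ-+ (X (m ∸ e * a)) (h e) (h′ e)))
                                  ([≤]·-distrib-+ (e * a) m (h e * X (m ∸ e * a)) (h′ e * X (m ∸ e * a)))))
  (∑<-distrib-+ (suc m) (λ e → [ e * a ≤ m ]· (h e * X (m ∸ e * a))) (λ e → [ e * a ≤ m ]· (h′ e * X (m ∸ e * a))))

dilated⊛-zero : ∀ a X m → dilated⊛ (λ _ → 0) a X m ≡ 0
dilated⊛-zero a X m = ∑<-vanishing (suc m) _ (λ e _ → [≤]·-zero (e * a) m)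

dilate-split : ∀ h a → 1 ≤ a → dilate h a ≗ (λ k → h 0 * oneS k) ⊕ (qPow a ⊛ dilate (h ∘ suc) a)
dilate-split h a 1≤a k = trans (dilated⊛-rec h a oneS k 1≤a)
  (cong (h 0 * oneS k +_) (sym (qPow-⊛ a (dilate (h ∘ suc) a) k)))

dilated⊛≗dilate-⊛ : ∀ h a X → 1 ≤ a → dilated⊛ h a X ≗ dilate h a ⊛ X
dilated⊛≗dilate-⊛ h a X 1≤a m = bounded (suc m) h m ≤-refl
  where
  open ≡-Reasoning
  bounded : ∀ bound h m → m < bound → dilated⊛ h a X m ≡ (dilate h a ⊛ X) m
  bounded (suc bound) h m m<bound = sym (begin
      (dilate h a ⊛ X) m
    ≡⟨ ⊛-cong (dilate-split h a 1≤a) (≗-refl {X}) m ⟩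
      (((λ k → h 0 * oneS k) ⊕ (qPow a ⊛ dilate (h ∘ suc) a)) ⊛ X) m
    ≡⟨ ⊛-distribʳ-⊕ (λ k → h 0 * oneS k) (qPow a ⊛ dilate (h ∘ suc) a) X m ⟩
      ((λ k → h 0 * oneS k) ⊛ X) m + ((qPow a ⊛ dilate (h ∘ suc) a) ⊛ X) m
    ≡⟨ cong₂ _+_ (trans (⊛-scaleˡ (h 0) oneS X m) (cong (h 0 *_) (⊛-identityˡ X m)))
                 (trans (⊛-assoc (qPow a) (dilate (h ∘ suc) a) X m) (qPow-⊛ a (dilate (h ∘ suc) a ⊛ X) m)) ⟩
      h 0 * X m + [ a ≤ m ]· (dilate (h ∘ suc) a ⊛ X) (m ∸ a)
    ≡⟨ cong (h 0 * X m +_) ([≤]·-cong a m (λ a≤m → sym (bounded bound (h ∘ suc) (m ∸ a)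
          (≤-trans (∸-monoʳ-< {m} {a} {0} 1≤a a≤m) (s≤s⁻¹ m<bound))))) ⟩
      h 0 * X m + [ a ≤ m ]· dilated⊛ (h ∘ suc) a X (m ∸ a)
    ≡⟨ sym (dilated⊛-rec h a X m 1≤a) ⟩
      dilated⊛ h a X m
    ∎)

binomial : ∀ c a X → 1 ≤ a → powS (1+q^ a) c ⊛ X ≗ dilated⊛ (c C_) a X
binomial zero a X 1≤a m = sym (begin
    dilated⊛ (0 C_) a X m
  ≡⟨ dilated⊛-rec (0 C_) a X m 1≤a ⟩
    1 * X m + [ a ≤ m ]· dilated⊛ (λ e → 0 C suc e) a X (m ∸ a)
  ≡⟨ cong (λ z → 1 * X m + [ a ≤ m ]· z)
       (trans (dilated⊛-cong a (λ e → k>n⇒nCk≡0 (z<s {e})) (≗-refl {X}) (m ∸ a)) (dilated⊛-zero a X (m ∸ a))) ⟩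
    1 * X m + [ a ≤ m ]· 0
  ≡⟨ cong₂ _+_ (*-identityˡ (X m)) ([≤]·-zero a m) ⟩
    X m + 0
  ≡⟨ +-identityʳ (X m) ⟩
    X m
  ≡⟨ sym (⊛-identityˡ X m) ⟩
    (powS (1+q^ a) 0 ⊛ X) m
  ∎) where open ≡-Reasoning
binomial (suc c) a X 1≤a m = begin
    (powS (1+q^ a) (suc c) ⊛ X) m
  ≡⟨ ⊛-assoc (1+q^ a) (powS (1+q^ a) c) X m ⟩
    (1+q^ a ⊛ (powS (1+q^ a) c ⊛ X)) m
  ≡⟨ ⊛-cong (≗-refl {1+q^ a}) (binomial c a X 1≤a) m ⟩
    (1+q^ a ⊛ F) m
  ≡⟨ 1+q^-⊛ a F m ⟩
    F m + [ a ≤ m ]· F (m ∸ a)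
  ≡⟨ cong (_+ [ a ≤ m ]· F (m ∸ a)) (dilated⊛-rec (c C_) a X m 1≤a) ⟩
    (1 * X m + [ a ≤ m ]· F′ (m ∸ a)) + [ a ≤ m ]· F (m ∸ a)
  ≡⟨ +-assoc (1 * X m) _ _ ⟩
    1 * X m + ([ a ≤ m ]· F′ (m ∸ a) + [ a ≤ m ]· F (m ∸ a))
  ≡⟨ cong (1 * X m +_) (trans (+-comm ([ a ≤ m ]· F′ (m ∸ a)) _)
                              (sym ([≤]·-distrib-+ a m (F (m ∸ a)) (F′ (m ∸ a))))) ⟩
    1 * X m + [ a ≤ m ]· (F (m ∸ a) + F′ (m ∸ a))
  ≡⟨ cong (λ z → 1 * X m + [ a ≤ m ]· z) (sym (dilated⊛-distrib-+ (c C_) (λ e → c C suc e) a X (m ∸ a))) ⟩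
    1 * X m + [ a ≤ m ]· dilated⊛ (λ e → c C e + c C suc e) a X (m ∸ a)
  ≡⟨ cong (λ z → 1 * X m + [ a ≤ m ]· z) (dilated⊛-cong a (nCk+nC[k+1]≡[n+1]C[k+1] c) (≗-refl {X}) (m ∸ a)) ⟩
    1 * X m + [ a ≤ m ]· dilated⊛ (λ e → suc c C suc e) a X (m ∸ a)
  ≡⟨ sym (dilated⊛-rec (suc c C_) a X m 1≤a) ⟩
    dilated⊛ (suc c C_) a X m
  ∎ where
    open ≡-Reasoning
    F F′ : PS
    F = dilated⊛ (c C_) a X
    F′ = dilated⊛ (λ e → c C suc e) a X

dilate-1 : ∀ h → dilate h 1 ≗ h
dilate-1 h zero = trans (dilated⊛-rec h 1 oneS 0 ≤-refl)
  (trans (cong (h 0 * 1 +_) ([≤]·-fails _ z<s)) (trans (+-identityʳ _) (*-identityʳ _)))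
dilate-1 h (suc m) = trans (dilated⊛-rec h 1 oneS (suc m) ≤-refl)
  (trans (cong₂ _+_ (*-zeroʳ (h 0)) ([≤]·-holds _ (s≤s z≤n))) (dilate-1 (h ∘ suc) m))

geom : ℕ → PS
geom a = dilate (λ _ → 1) a

geom-0 : ∀ a → 1 ≤ a → geom a 0 ≡ 1
geom-0 a 1≤a = trans (dilated⊛-rec (λ _ → 1) a oneS 0 1≤a) (cong (1 +_) ([≤]·-fails _ 1≤a))

geom-vanish : ∀ a k → 0 < k → k < a → geom a k ≡ 0
geom-vanish a (suc k) _ k<a = trans (dilated⊛-rec (λ _ → 1) a oneS (suc k) (≤-trans (s≤s z≤n) k<a)) ([≤]·-fails _ k<a)

geom-+a : ∀ a k → 1 ≤ a → geom a (k + a) ≡ geom a k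
geom-+a (suc a) k _ = trans (dilated⊛-rec (λ _ → 1) (suc a) oneS (k + suc a) (s≤s z≤n))
  (trans (cong₂ _+_ (cong (λ z → 1 * oneS z) (+-suc k a)) ([≤]·-holds _ (m≤n+m (suc a) k)))
         (cong (geom (suc a)) (m+n∸n≡m k (suc a))))

geom-periodic : ∀ a k j → 1 ≤ a → geom a (k + j * a) ≡ geom a k
geom-periodic a k zero 1≤a = cong (geom a) (+-identityʳ k)
geom-periodic a k (suc j) 1≤a =
  trans (cong (geom a) (trans (cong (k +_) (+-comm a (j * a))) (sym (+-assoc k (j * a) a))))
    (trans (geom-+a a (k + j * a) 1≤a) (geom-periodic a k j 1≤a))

partialSums-0 : ∀ X → (geom 1 ⊛ X) 0 ≡ X 0
partialSums-0 X = trans (⊛-at-0 (geom 1) X) (trans (cong (_* X 0) (dilate-1 (λ _ → 1) 0)) (*-identityˡ (X 0)))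

partialSums-suc : ∀ X m → (geom 1 ⊛ X) (suc m) ≡ X (suc m) + (geom 1 ⊛ X) m
partialSums-suc X m = trans (⊛-at-suc (geom 1) X m) (cong₂ _+_
  (trans (cong (_* X (suc m)) (dilate-1 (λ _ → 1) 0)) (*-identityˡ (X (suc m))))
  (⊛-cong (λ k → trans (dilate-1 (λ _ → 1) (suc k)) (sym (dilate-1 (λ _ → 1) k))) (≗-refl {X}) m))

partialSums-q² : ∀ m → (geom 1 ⊛ qPow 2) (2 + m) ≡ 1
partialSums-q² zero = trans (partialSums-suc (qPow 2) 1)
  (cong (1 +_) (trans (partialSums-suc (qPow 2) 0) (partialSums-0 (qPow 2))))
partialSums-q² (suc m) = trans (partialSums-suc (qPow 2) (2 + m)) (partialSums-q² m)

partialSums²-q² : ∀ m → (geom 1 ⊛ (geom 1 ⊛ qPow 2)) m ≡ m ∸ 1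
partialSums²-q² zero = trans (partialSums-0 (geom 1 ⊛ qPow 2)) (partialSums-0 (qPow 2))
partialSums²-q² (suc zero) = trans (partialSums-suc (geom 1 ⊛ qPow 2) 0)
  (cong₂ _+_ (trans (partialSums-suc (qPow 2) 0) (partialSums-0 (qPow 2))) (partialSums²-q² 0))
partialSums²-q² (suc (suc m)) = trans (partialSums-suc (geom 1 ⊛ qPow 2) (suc m))
  (cong₂ _+_ (partialSums-q² m) (partialSums²-q² (suc m)))

choose2Series : PS
choose2Series = geom 1 ⊛ (geom 1 ⊛ (geom 1 ⊛ qPow 2))

choose2Series-coeff : ∀ m → choose2Series m ≡ m C 2
choose2Series-coeff zero = trans (partialSums-0 (geom 1 ⊛ (geom 1 ⊛ qPow 2))) (partialSums²-q² 0)
choose2Series-coeff (suc m) = begin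
    choose2Series (suc m)
  ≡⟨ partialSums-suc (geom 1 ⊛ (geom 1 ⊛ qPow 2)) m ⟩
    (geom 1 ⊛ (geom 1 ⊛ qPow 2)) (suc m) + choose2Series m
  ≡⟨ cong₂ _+_ (trans (partialSums²-q² (suc m)) (sym (nC1≡n m))) (choose2Series-coeff m) ⟩
    m C 1 + m C 2
  ≡⟨ nCk+nC[k+1]≡[n+1]C[k+1] m 1 ⟩
    suc m C 2
  ∎ where open ≡-Reasoning

-- Binary products

factorFrom : ℕ → ℕ → PS → PS
factorFrom s i F = if s ≤ᵇ i then F else oneS

factorFrom-≤ : ∀ {s i} F → s ≤ i → factorFrom s i F ≡ F
factorFrom-≤ {s} {i} F s≤i with s ≤ᵇ i | ≤⇒≤ᵇ s≤i
... | true | _ = refl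

factorFrom-> : ∀ {s i} F → i < s → factorFrom s i F ≡ oneS
factorFrom-> {s} {i} F i<s with s ≤ᵇ i in eq
... | false = refl
... | true = ⊥-elim (<⇒≱ i<s (≤ᵇ⇒≤ s i (subst T (sym eq) tt)))

n<2^n : ∀ n → n < 2 ^ n
n<2^n zero = s≤s z≤n
n<2^n (suc n) = <-≤-trans (s<s (n<2^n n)) (≤-trans (+-monoʳ-≤ 1 (m≤m+n (2 ^ n) 0)) (+-monoˡ-≤ (2 ^ n + 0) (m^n>0 2 n)))

binaryProduct : ℕ → ℕ → PS
binaryProduct s N = prodS N (λ i → factorFrom s i (1+q^ (2 ^ i)))

binaryProduct-step : ∀ s N k → s ≤ N →
  binaryProduct s (suc N) k ≡ binaryProduct s N k + [ 2 ^ N ≤ k ]· binaryProduct s N (k ∸ 2 ^ N)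
binaryProduct-step s N k s≤N =
  trans (⊛-cong (≗-refl {binaryProduct s N}) (λ j → cong (λ F → F j) (factorFrom-≤ (1+q^ (2 ^ N)) s≤N)) k)
        (trans (⊛-comm (binaryProduct s N) (1+q^ (2 ^ N)) k) (1+q^-⊛ (2 ^ N) (binaryProduct s N) k))

binaryProduct-skip : ∀ s N → N < s → binaryProduct s (suc N) ≗ binaryProduct s N
binaryProduct-skip s N N<s k =
  trans (⊛-cong (≗-refl {binaryProduct s N}) (λ j → cong (λ F → F j) (factorFrom-> (1+q^ (2 ^ N)) N<s)) k)
        (⊛-identityʳ (binaryProduct s N) k)

-- Truncation of Euler's identity ∏_{i ≥ s} (1 + q^(2^i)) = 1/(1 - q^(2^s)), read off from binary expansions.
binaryProduct-coeff : ∀ s N k → (k < 2 ^ N → binaryProduct s N k ≡ geom (2 ^ s) k)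
                                × (2 ^ N ≤ k → binaryProduct s N k ≡ 0)
binaryProduct-coeff s zero zero = (λ _ → sym (geom-0 (2 ^ s) (m^n>0 2 s))) , (λ ())
binaryProduct-coeff s zero (suc k) = (λ { (s≤s ()) }) , (λ _ → refl)
binaryProduct-coeff s (suc N) k with s ≤? N
... | yes s≤N = below , above
  where
  a : ℕ
  a = 2 ^ N
  a+a≡ : 2 ^ suc N ≡ a + a
  a+a≡ = cong (a +_) (+-identityʳ a)
  below : k < 2 ^ suc N → binaryProduct s (suc N) k ≡ geom (2 ^ s) k
  below k<2a with k <? a
  ... | yes k<a = trans (binaryProduct-step s N k s≤N)
        (trans (cong₂ _+_ (proj₁ (binaryProduct-coeff s N k) k<a) ([≤]·-fails _ k<a)) (+-identityʳ _))
  ... | no k≮a = trans (binaryProduct-step s N k s≤N)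
        (trans (cong₂ _+_ (proj₂ (binaryProduct-coeff s N k) a≤k) ([≤]·-holds _ a≤k))
          (trans (proj₁ (binaryProduct-coeff s N (k ∸ a)) k∸a<a)
            (trans (sym (geom-periodic (2 ^ s) (k ∸ a) (2 ^ (N ∸ s)) (m^n>0 2 s)))
              (cong (geom (2 ^ s)) (trans (cong ((k ∸ a) +_) (sym a≡)) (m∸n+n≡m a≤k))))))
    where
    a≤k : a ≤ k
    a≤k = ≮⇒≥ k≮a
    k∸a<a : k ∸ a < a
    k∸a<a = +-cancelˡ-< a (k ∸ a) a (subst (_< a + a) (sym (m+[n∸m]≡n a≤k)) (subst (k <_) a+a≡ k<2a))
    a≡ : a ≡ 2 ^ (N ∸ s) * 2 ^ s
    a≡ = trans (cong (2 ^_) (sym (m∸n+n≡m s≤N))) (^-distribˡ-+-* 2 (N ∸ s) s)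
  above : 2 ^ suc N ≤ k → binaryProduct s (suc N) k ≡ 0
  above 2a≤k = trans (binaryProduct-step s N k s≤N) (cong₂ _+_ (proj₂ (binaryProduct-coeff s N k) a≤k)
    (trans ([≤]·-cong a k (λ _ → proj₂ (binaryProduct-coeff s N (k ∸ a))
               (+-cancelˡ-≤ a a (k ∸ a) (subst (a + a ≤_) (sym (m+[n∸m]≡n a≤k)) (subst (_≤ k) a+a≡ 2a≤k)))))
           ([≤]·-zero a k)))
    where
    a≤k : a ≤ k
    a≤k = ≤-trans (m≤m+n a (a + 0)) 2a≤k
... | no s≰N = below , above
  where
  skip : binaryProduct s (suc N) k ≡ binaryProduct s N k
  skip = binaryProduct-skip s N (≰⇒> s≰N) k
  below : k < 2 ^ suc N → binaryProduct s (suc N) k ≡ geom (2 ^ s) k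
  below k<2a with k <? 2 ^ N
  ... | yes k<a = trans skip (proj₁ (binaryProduct-coeff s N k) k<a)
  ... | no k≮a = trans skip (trans (proj₂ (binaryProduct-coeff s N k) (≮⇒≥ k≮a))
        (sym (geom-vanish (2 ^ s) k (<-≤-trans (m^n>0 2 N) (≮⇒≥ k≮a)) (<-≤-trans k<2a (^-monoʳ-≤ 2 (≰⇒> s≰N))))))
  above : 2 ^ suc N ≤ k → binaryProduct s (suc N) k ≡ 0
  above 2a≤k = trans skip (proj₂ (binaryProduct-coeff s N k) (≤-trans (m≤m+n (2 ^ N) (2 ^ N + 0)) 2a≤k))

onesGF : ℕ → ℕ → PS
onesGF D zero = choose2Series
onesGF D (suc K) = geom (D ^ suc K) ⊛ onesGF D K

module _ (d : ℕ) .{{_ : NonZero d}} where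

  partialProduct : ℕ → PS
  partialProduct N = prodS N (factor d)

  partialProduct-stable : ∀ m N t → m < N → partialProduct (N + t) m ≡ partialProduct N m
  partialProduct-stable m N zero m<N = cong (λ N′ → partialProduct N′ m) (+-identityʳ N)
  partialProduct-stable m N (suc t) m<N = trans (cong (λ N′ → partialProduct N′ m) (+-suc N t))
    (trans (newFactorInvisible (N + t) (<-≤-trans m<N (≤-trans (m≤m+n N t) (<⇒≤ (n<2^n (N + t))))))
      (partialProduct-stable m N t m<N))
    where
    newFactorInvisible : ∀ N → m < 2 ^ N → partialProduct (suc N) m ≡ partialProduct N m
    newFactorInvisible N m<2^N = begin
        partialProduct (suc N) m
      ≡⟨ ⊛-comm (partialProduct N) (factor d N) m ⟩
        (factor d N ⊛ partialProduct N) m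
      ≡⟨ binomial (nColours d N) (2 ^ N) (partialProduct N) (m^n>0 2 N) m ⟩
        dilated⊛ (nColours d N C_) (2 ^ N) (partialProduct N) m
      ≡⟨ dilated⊛-rec (nColours d N C_) (2 ^ N) (partialProduct N) m (m^n>0 2 N) ⟩
        1 * partialProduct N m + [ 2 ^ N ≤ m ]· _
      ≡⟨ cong₂ _+_ (*-identityˡ (partialProduct N m)) ([≤]·-fails _ m<2^N) ⟩
        partialProduct N m + 0
      ≡⟨ +-identityʳ _ ⟩
        partialProduct N m
      ∎ where open ≡-Reasoning

  partialRHS-shift : ∀ n N → partialRHS d N (n + 2) ≡ partialProduct N n
  partialRHS-shift n N = trans (qPow-⊛ 2 (partialProduct N) (n + 2))
    (trans ([≤]·-holds _ (m≤n+m 2 n)) (cong (partialProduct N) (m+n∸n≡m n 2)))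

  binaryProducts : ℕ → ℕ → PS
  binaryProducts K N = prodS K (λ j → binaryProduct (d * suc j) N)

  extraFactor : ℕ → ℕ → PS
  extraFactor N j = factorFrom (d * suc j) N (1+q^ (2 ^ N))

  private
    d[1+j]≤N⇒j<N/d : ∀ j N → d * suc j ≤ N → j < N / d
    d[1+j]≤N⇒j<N/d j N le = subst (_≤ N / d) (m*n/n≡m (suc j) d) (/-monoˡ-≤ d (subst (_≤ N) (*-comm d (suc j)) le))

    j<N/d⇒d[1+j]≤N : ∀ j N → j < N / d → d * suc j ≤ N
    j<N/d⇒d[1+j]≤N j N lt = subst (_≤ N) (*-comm (suc j) d) (≤-trans (*-monoˡ-≤ d lt) (m/n*n≤m N d))

    extraFactors-≤ : ∀ N K → K ≤ N / d → prodS K (extraFactor N) ≗ powS (1+q^ (2 ^ N)) K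
    extraFactors-≤ N zero _ = ≗-refl
    extraFactors-≤ N (suc K) K<N/d = ≗-trans
      (⊛-cong (extraFactors-≤ N K (≤-trans (n≤1+n K) K<N/d)) (≡⇒≗ (factorFrom-≤ _ (j<N/d⇒d[1+j]≤N K N K<N/d))))
      (⊛-comm (powS (1+q^ (2 ^ N)) K) (1+q^ (2 ^ N)))

    extraFactors-+ : ∀ N t → prodS (N / d + t) (extraFactor N) ≗ powS (1+q^ (2 ^ N)) (N / d)
    extraFactors-+ N zero = ≗-trans (≡⇒≗ (cong (λ K → prodS K (extraFactor N)) (+-identityʳ (N / d))))
      (extraFactors-≤ N (N / d) ≤-refl)
    extraFactors-+ N (suc t) = ≗-trans (≡⇒≗ (cong (λ K → prodS K (extraFactor N)) (+-suc (N / d) t)))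
      (≗-trans (⊛-cong (extraFactors-+ N t)
                       (≡⇒≗ (factorFrom-> _ (≰⇒> (λ le → <⇒≱ (d[1+j]≤N⇒j<N/d (N / d + t) N le)
                                                           (m≤m+n (N / d) t))))))
        (⊛-identityʳ _))

  -- binaryProduct (d (j+1)) N has the factor 1 + q^(2^N) iff d (j+1) ≤ N, i.e. iff j < ⌊N/d⌋.
  extraFactors : ∀ N K → N / d ≤ K → prodS K (extraFactor N) ≗ powS (1+q^ (2 ^ N)) (N / d)
  extraFactors N K N/d≤K = ≗-trans (≡⇒≗ (cong (λ K′ → prodS K′ (extraFactor N)) (sym (m+[n∸m]≡n N/d≤K))))
    (extraFactors-+ N (K ∸ N / d))

  partialProduct-regroup : ∀ N K → N ≤ K →
    partialProduct N ≗ ((binaryProduct 0 N ⊛ binaryProduct 0 N) ⊛ binaryProduct 0 N) ⊛ binaryProducts K N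
  partialProduct-regroup zero K _ = ≗-sym (≗-trans
    (⊛-cong (≗-trans (⊛-identityʳ (oneS ⊛ oneS)) (⊛-identityʳ oneS)) (prodS-oneS K)) (⊛-identityʳ oneS))
  partialProduct-regroup (suc N) K N<K = ≗-trans
    (⊛-cong (partialProduct-regroup N K (≤-trans (n≤1+n N) N<K)) (powS-+ F (N / d) 3))
    (≗-trans (prove 4 lhs rhs (G ∷ F ∷ H ∷ powS F (N / d) ∷ []))
      (≗-sym (⊛-cong (≗-refl {((G ⊛ F) ⊛ (G ⊛ F)) ⊛ (G ⊛ F)})
        (≗-trans (prodS-⊛ K (λ j → binaryProduct (d * suc j) N) (extraFactor N))
          (⊛-cong (≗-refl {H}) (extraFactors N K (≤-trans (m/n≤m N d) (≤-trans (n≤1+n N) N<K))))))))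
    where
    F G H : PS
    F = 1+q^ (2 ^ N)
    G = binaryProduct 0 N
    H = binaryProducts K N
    g b j p lhs rhs : Expr 4
    g = var zero ; b = var (suc zero) ; j = var (suc (suc zero)) ; p = var (suc (suc (suc zero)))
    lhs = (((g ⊙ g) ⊙ g) ⊙ j) ⊙ (p ⊙ (b ⊙ (b ⊙ (b ⊙ ε))))
    rhs = (((g ⊙ b) ⊙ (g ⊙ b)) ⊙ (g ⊙ b)) ⊙ (j ⊙ p)

  onesGF-partialRHS : ∀ n N → n < N → onesGF (2 ^ d) N n ≡ partialRHS d N n
  onesGF-partialRHS n N n<N = trans (regrouped N n ≤-refl) (sym final)
    where
    G : PS
    G = binaryProduct 0 N
    Y : PS
    Y = G ⊛ (G ⊛ (G ⊛ qPow 2))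
    geom≗[≤]binaryProduct : ∀ s → geom (2 ^ s) ≗[≤ n ] binaryProduct s N
    geom≗[≤]binaryProduct s k k≤n = sym (proj₁ (binaryProduct-coeff s N k) (≤-<-trans k≤n (<-trans n<N (n<2^n N))))
    regrouped : ∀ K → onesGF (2 ^ d) K ≗[≤ n ] binaryProducts K N ⊛ Y
    regrouped zero = ≗[≤]-trans n
      (⊛-cong-≤ n (geom≗[≤]binaryProduct 0) (⊛-cong-≤ n (geom≗[≤]binaryProduct 0)
        (⊛-cong-≤ n (geom≗[≤]binaryProduct 0) (≗⇒≗[≤] n (≗-refl {qPow 2})))))
      (≗⇒≗[≤] n (≗-sym (⊛-identityˡ Y)))
    regrouped (suc K) = ≗[≤]-trans n
      (⊛-cong-≤ n (λ k k≤n → trans (cong (λ a → geom a k) (^-*-assoc 2 d (suc K)))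
                                   (geom≗[≤]binaryProduct (d * suc K) k k≤n))
                  (regrouped K))
      (≗⇒≗[≤] n (≗-trans (≗-sym (⊛-assoc (binaryProduct (d * suc K) N) (binaryProducts K N) Y))
        (⊛-cong (⊛-comm (binaryProduct (d * suc K) N) (binaryProducts K N)) (≗-refl {Y}))))
    final : partialRHS d N n ≡ (binaryProducts N N ⊛ Y) n
    final = trans (⊛-cong (≗-refl {qPow 2}) (partialProduct-regroup N N ≤-refl) n)
      (prove 3 (q ⊙ (((g ⊙ g) ⊙ g) ⊙ j)) (j ⊙ (g ⊙ (g ⊙ (g ⊙ q)))) (qPow 2 ∷ G ∷ binaryProducts N N ∷ []) n)
      where
      q g j : Expr 3
      q = var zero ; g = var (suc zero) ; j = var (suc (suc zero))

-- Lists and enumerations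

Enumeration-↭ : ∀ {A : Set} {P : A → Set} (E F : Enumeration P) → elems E ↭ elems F
Enumeration-↭ E F = ∼bag⇒↭ (unique∧set⇒bag (unique E) (unique F)
  (λ {x} → mk⇔ (λ x∈E → Equivalence.from (complete F x) (Equivalence.to (complete E x) x∈E))
               (λ x∈F → Equivalence.from (complete E x) (Equivalence.to (complete F x) x∈F))))

Enumeration-sum : ∀ {A : Set} {P : A → Set} (f : A → ℕ) (E F : Enumeration P) →
                  sum (map f (elems E)) ≡ sum (map f (elems F))
Enumeration-sum f E F = sum-↭ (↭.map⁺ f (Enumeration-↭ E F))

filterEnumeration : ∀ {A : Set} {P Q : A → Set} → Enumeration P → Decidable Q → Enumeration (λ x → P x × Q x)
filterEnumeration E Q? = record
  { elems = filter Q? (elems E)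
  ; unique = Unique.filter⁺ Q? (unique E)
  ; complete = λ x → mk⇔
      (λ x∈ → let x∈E , qx = ∈-filter⁻ Q? {xs = elems E} x∈ in Equivalence.to (complete E x) x∈E , qx)
      (λ (px , qx) → ∈-filter⁺ Q? (Equivalence.from (complete E x) px) qx)
  }

Unique-map⁺-injectiveOn : ∀ {A B : Set} (f : A → B) {xs} → Unique xs →
                          (∀ {x y} → x ∈ xs → y ∈ xs → f x ≡ f y → x ≡ y) → Unique (map f xs)
Unique-map⁺-injectiveOn f [] _ = []
Unique-map⁺-injectiveOn f (x∉xs ∷ xs!) inj =
  All.map⁺ (tabulate (λ y∈ fx≡fy → lookup x∉xs y∈ (inj (here refl) (there y∈) fx≡fy))) ∷
  Unique-map⁺-injectiveOn f xs! (λ x∈ y∈ → inj (there x∈) (there y∈))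

module _ {A : Set} {R : Rel A 0ℓ} where

  headRelates : Transitive R → ∀ {x xs} → Linked R (x ∷ xs) → All (R x) xs
  headRelates tr [-] = []
  headRelates tr (r ∷ l) = Linked⇒All tr r l

  linked-∷ : ∀ {x xs} → All (R x) xs → Linked R xs → Linked R (x ∷ xs)
  linked-∷ [] [] = [-]
  linked-∷ (r ∷ _) l = r ∷ l

  linked-++ : Transitive R → ∀ xs {ys} → Linked R xs → Linked R ys → All (λ x → All (R x) ys) xs → Linked R (xs ++ ys)
  linked-++ tr [] _ l _ = l
  linked-++ tr (x ∷ xs) lx ly (ax ∷ axs) =
    linked-∷ (All.++⁺ (headRelates tr lx) ax) (linked-++ tr xs (Linked.tail lx) ly axs)

  linked-++⁻ʳ : ∀ xs {ys} → Linked R (xs ++ ys) → Linked R ys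
  linked-++⁻ʳ [] l = l
  linked-++⁻ʳ (x ∷ xs) l = linked-++⁻ʳ xs (Linked.tail l)

sum-replicate : ∀ e a → sum (replicate e a) ≡ e * a
sum-replicate zero a = refl
sum-replicate (suc e) a = cong (a +_) (sum-replicate e a)

∈⇒≤sum : ∀ {x xs} → x ∈ xs → x ≤ sum xs
∈⇒≤sum {xs = y ∷ ys} (here refl) = m≤m+n y (sum ys)
∈⇒≤sum {xs = y ∷ ys} (there x∈) = ≤-trans (∈⇒≤sum x∈) (m≤n+m (sum ys) y)

sum-map-cong : ∀ {A : Set} {f g : A → ℕ} xs → (∀ {x} → x ∈ xs → f x ≡ g x) → sum (map f xs) ≡ sum (map g xs)
sum-map-cong [] _ = refl
sum-map-cong (x ∷ xs) f≡g = cong₂ _+_ (f≡g (here refl)) (sum-map-cong xs (f≡g ∘ there))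

sum-map-*ˡ : ∀ {A : Set} c (f : A → ℕ) xs → sum (map (λ x → c * f x) xs) ≡ c * sum (map f xs)
sum-map-*ˡ c f [] = sym (*-zeroʳ c)
sum-map-*ˡ c f (x ∷ xs) = trans (cong (c * f x +_) (sum-map-*ˡ c f xs)) (sym (*-distribˡ-+ c (f x) _))

sum-concatMap : ∀ {A B : Set} (w : B → ℕ) (F : A → List B) xs →
                sum (map w (concatMap F xs)) ≡ sum (map (λ x → sum (map w (F x))) xs)
sum-concatMap w F [] = refl
sum-concatMap w F (x ∷ xs) = trans (cong sum (map-++ w (F x) (concatMap F xs)))
  (trans (sum-++ (map w (F x)) (map w (concatMap F xs))) (cong (sum (map w (F x)) +_) (sum-concatMap w F xs)))

sum-filter-nonzero : ∀ {A : Set} (f : A → ℕ) xs → sum (map f (filter (λ x → 1 ≤? f x) xs)) ≡ sum (map f xs)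
sum-filter-nonzero f [] = refl
sum-filter-nonzero f (x ∷ xs) with 0 <ᵇ f x in eq
... | true = cong (f x +_) (sum-filter-nonzero f xs)
... | false = trans (sum-filter-nonzero f xs) (cong (_+ sum (map f xs)) (sym (<ᵇ-false (f x) eq)))
  where
  <ᵇ-false : ∀ k → (0 <ᵇ k) ≡ false → k ≡ 0
  <ᵇ-false zero _ = refl

sum-map-[≤]· : ∀ {A : Set} w n (g : A → ℕ) xs → sum (map (λ s → [ w ≤ n ]· g s) xs) ≡ [ w ≤ n ]· sum (map g xs)
sum-map-[≤]· w n g [] = sym ([≤]·-zero w n)
sum-map-[≤]· w n g (x ∷ xs) = trans (cong ([ w ≤ n ]· g x +_) (sum-map-[≤]· w n g xs)) (sym ([≤]·-distrib-+ w n (g x) _))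

when≤ : ∀ {A : Set} → ℕ → ℕ → List A → List A
when≤ a m L = if a ≤ᵇ m then L else []

when≤-holds : ∀ {A : Set} {a m} (L : List A) → a ≤ m → when≤ a m L ≡ L
when≤-holds {a = a} {m} L a≤m with a ≤ᵇ m | ≤⇒≤ᵇ a≤m
... | true | _ = refl

when≤-fails : ∀ {A : Set} {a m} (L : List A) → m < a → when≤ a m L ≡ []
when≤-fails {a = a} {m} L m<a with a ≤ᵇ m in eq
... | false = refl
... | true = ⊥-elim (<⇒≱ m<a (≤ᵇ⇒≤ a m (subst T (sym eq) tt)))

sum-when≤ : ∀ {A : Set} (w : A → ℕ) a m (L : List A) → sum (map w (when≤ a m L)) ≡ [ a ≤ m ]· sum (map w L)
sum-when≤ w a m L with a ≤? m
... | yes a≤m = trans (cong (sum ∘ map w) (when≤-holds L a≤m)) (sym ([≤]·-holds _ a≤m))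
... | no a≰m = trans (cong (sum ∘ map w) (when≤-fails L (≰⇒> a≰m))) (sym ([≤]·-fails _ (≰⇒> a≰m)))

∈-when≤⁻ : ∀ {A : Set} {a m} {x : A} (L : List A) → x ∈ when≤ a m L → a ≤ m × x ∈ L
∈-when≤⁻ {a = a} {m} L x∈ with a ≤? m
... | yes a≤m = a≤m , subst (_ ∈_) (when≤-holds L a≤m) x∈
... | no a≰m with () ← subst (_ ∈_) (when≤-fails L (≰⇒> a≰m)) x∈

-- Partitions with prescribed parts

ValidParts : List ℕ → Set
ValidParts ps = Linked _>_ ps × All (2 ≤_) ps

IsPartitionInto : List ℕ → ℕ → List ℕ → Set
IsPartitionInto ps m λ′ = Linked _≥_ λ′ × All (λ x → x ≡ 1 ⊎ x ∈ ps) λ′ × sum λ′ ≡ m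

partitionsInto : List ℕ → ℕ → List (List ℕ)
withLeading : ℕ → List ℕ → ℕ → ℕ → List (List ℕ)

partitionsInto [] m = replicate m 1 ∷ []
partitionsInto (a ∷ as) m = concatMap (withLeading a as m) (upTo (suc m))

withLeading a as m e = when≤ (e * a) m (map (replicate e a ++_) (partitionsInto as (m ∸ e * a)))

ValidParts-tail : ∀ {a as} → ValidParts (a ∷ as) → ValidParts as
ValidParts-tail (l , _ ∷ 2≤as) = Linked.tail l , 2≤as

ValidParts-below : ∀ {a as} → ValidParts (a ∷ as) → ∀ {x} → x ≡ 1 ⊎ x ∈ as → x < a
ValidParts-below (_ , 2≤a ∷ _) (inj₁ refl) = 2≤a
ValidParts-below (l , _) (inj₂ x∈as) = lookup (headRelates (λ x>y y>z → <-trans y>z x>y) l) x∈as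

ValidParts-atMost : ∀ {a as} → ValidParts (a ∷ as) → ∀ {x} → x ≡ 1 ⊎ x ∈ a ∷ as → x ≤ a
ValidParts-atMost (_ , 2≤a ∷ _) (inj₁ refl) = ≤-trans (s≤s z≤n) 2≤a
ValidParts-atMost v (inj₂ (here refl)) = ≤-refl
ValidParts-atMost v (inj₂ (there x∈as)) = <⇒≤ (ValidParts-below v (inj₂ x∈as))

linked-replicate : ∀ e a {xs} → All (_≤ a) xs → Linked _≥_ xs → Linked _≥_ (replicate e a ++ xs)
linked-replicate zero a _ l = l
linked-replicate (suc e) a xs≤a l =
  linked-∷ (All.++⁺ (All.replicate⁺ e ≤-refl) xs≤a) (linked-replicate e a xs≤a l)

IsPartitionInto-replicate : ∀ {a as} e m λ′ → ValidParts (a ∷ as) → e * a ≤ m →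
  IsPartitionInto as (m ∸ e * a) λ′ → IsPartitionInto (a ∷ as) m (replicate e a ++ λ′)
IsPartitionInto-replicate {a} e m λ′ v ea≤m (l , parts , Σλ′) =
  linked-replicate e a (All.map (λ p → <⇒≤ (ValidParts-below v p)) parts) l ,
  All.++⁺ (All.replicate⁺ e (inj₂ (here refl))) (All.map (map₂ there) parts) ,
  trans (sum-++ (replicate e a) λ′) (trans (cong₂ _+_ (sum-replicate e a) Σλ′) (m+[n∸m]≡n ea≤m))

partitionsInto-sound : ∀ ps m λ′ → ValidParts ps → λ′ ∈ partitionsInto ps m → IsPartitionInto ps m λ′
partitionsInto-sound [] m _ _ (here refl) =
  ones m , All.replicate⁺ m (inj₁ refl) , trans (sum-replicate m 1) (*-identityʳ m)
  where
  ones : ∀ m → Linked _≥_ (replicate m 1)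
  ones zero = []
  ones (suc zero) = [-]
  ones (suc (suc m)) = ≤-refl ∷ ones (suc m)
partitionsInto-sound (a ∷ as) m λ′ v λ′∈
  with e , _ , λ′∈e ← find (∈-concatMap⁻ (withLeading a as m) {xs = upTo (suc m)} λ′∈)
  with ea≤m , λ′∈map ← ∈-when≤⁻ (map (replicate e a ++_) (partitionsInto as (m ∸ e * a))) λ′∈e
  with μ , μ∈ , refl ← ∈-map⁻ (replicate e a ++_) λ′∈map
  = IsPartitionInto-replicate e m μ v ea≤m (partitionsInto-sound as (m ∸ e * a) μ (ValidParts-tail v) μ∈)

splitLeading : ∀ a λ′ → Linked _≥_ λ′ → All (_≤ a) λ′ →
               ∃[ e ] ∃[ μ ] (λ′ ≡ replicate e a ++ μ × All (_< a) μ)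
splitLeading a [] _ _ = 0 , [] , refl , []
splitLeading a (x ∷ xs) l (x≤a ∷ xs≤a) with x ≟ a
... | yes refl with e , μ , eq , μ<a ← splitLeading a xs (Linked.tail l) xs≤a
  = suc e , μ , cong (a ∷_) eq , μ<a
... | no x≢a =
  0 , x ∷ xs , refl , x<a ∷ All.map (λ y≤x → ≤-<-trans y≤x x<a) (headRelates (λ x≥y y≥z → ≤-trans y≥z x≥y) l)
  where
  x<a : x < a
  x<a = ≤∧≢⇒< x≤a x≢a

all≡1⇒replicate : ∀ λ′ → All (_≡ 1) λ′ → λ′ ≡ replicate (sum λ′) 1
all≡1⇒replicate [] _ = refl
all≡1⇒replicate (.1 ∷ xs) (refl ∷ xs≡1) = cong (1 ∷_) (all≡1⇒replicate xs xs≡1)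

partitionsInto-complete : ∀ ps m λ′ → ValidParts ps → IsPartitionInto ps m λ′ → λ′ ∈ partitionsInto ps m
partitionsInto-complete [] m λ′ _ (_ , parts , Σλ′) =
  here (trans (all≡1⇒replicate λ′ (All.map one parts)) (cong (λ k → replicate k 1) Σλ′))
  where
  one : ∀ {x} → x ≡ 1 ⊎ x ∈ [] → x ≡ 1
  one (inj₁ x≡1) = x≡1
partitionsInto-complete (a ∷ as) m λ′ v@(_ , 2≤a ∷ _) (l , parts , Σλ′)
  with e , μ , refl , μ<a ← splitLeading a λ′ l (All.map (ValidParts-atMost v) parts)
  = ∈-concatMap⁺ (withLeading a as m) (lose (∈-upTo⁺ e≤m) μ∈)
  where
  Σ≡ : e * a + sum μ ≡ m
  Σ≡ = trans (sym (trans (sum-++ (replicate e a) μ) (cong (_+ sum μ) (sum-replicate e a)))) Σλ′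
  ea≤m : e * a ≤ m
  ea≤m = subst (e * a ≤_) Σ≡ (m≤m+n (e * a) (sum μ))
  e≤m : e < suc m
  e≤m = s≤s (≤-trans (m≤m*n e a {{>-nonZero (≤-trans (s≤s z≤n) 2≤a)}}) ea≤m)
  notLeading : ∀ {x} → x ≡ 1 ⊎ x ∈ a ∷ as → x < a → x ≡ 1 ⊎ x ∈ as
  notLeading (inj₁ x≡1) _ = inj₁ x≡1
  notLeading (inj₂ (here refl)) a<a = ⊥-elim (<-irrefl refl a<a)
  notLeading (inj₂ (there x∈as)) _ = inj₂ x∈as
  μ-partition : IsPartitionInto as (m ∸ e * a) μ
  μ-partition = linked-++⁻ʳ (replicate e a) l ,
                All.zipWith (λ (p , x<a) → notLeading p x<a) (All.++⁻ʳ (replicate e a) parts , μ<a) ,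
                trans (sym (m+n∸m≡n (e * a) (sum μ))) (cong (_∸ e * a) Σ≡)
  μ∈ : replicate e a ++ μ ∈ withLeading a as m e
  μ∈ = subst (_ ∈_) (sym (when≤-holds _ ea≤m))
         (∈-map⁺ (replicate e a ++_) (partitionsInto-complete as (m ∸ e * a) μ (ValidParts-tail v) μ-partition))

replicate-++-injective : ∀ a e e′ {xs ys} → All (_< a) xs → All (_< a) ys →
                         replicate e a ++ xs ≡ replicate e′ a ++ ys → e ≡ e′
replicate-++-injective a zero zero _ _ _ = refl
replicate-++-injective a zero (suc e′) (x<a ∷ _) _ eq with refl , _ ← ∷-injective eq = ⊥-elim (<-irrefl refl x<a)
replicate-++-injective a (suc e) zero _ (y<a ∷ _) eq with refl , _ ← ∷-injective eq = ⊥-elim (<-irrefl refl y<a)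
replicate-++-injective a (suc e) (suc e′) xs<a ys<a eq =
  cong suc (replicate-++-injective a e e′ xs<a ys<a (proj₂ (∷-injective eq)))

partitionsInto-unique : ∀ ps m → ValidParts ps → Unique (partitionsInto ps m)
partitionsInto-unique [] m _ = [] ∷ []
partitionsInto-unique (a ∷ as) m v =
  Unique.concat⁺ (All.map⁺ {xs = upTo (suc m)} (tabulate (λ {e} _ → uniqueFor e)))
                 (AllPairs.map⁺ {xs = upTo (suc m)} (AllPairs.map (λ {e} {e′} → disjointFor e e′) (Unique.upTo⁺ (suc m))))
  where
  uniqueFor : ∀ e → Unique (withLeading a as m e)
  uniqueFor e with e * a ≤? m
  ... | yes ea≤m = subst Unique (sym (when≤-holds _ ea≤m))
          (Unique.map⁺ (λ {x} {y} → ++-cancelˡ (replicate e a) x y) (partitionsInto-unique as (m ∸ e * a) (ValidParts-tail v)))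
  ... | no ea≰m = subst Unique (sym (when≤-fails _ (≰⇒> ea≰m))) []
  below : ∀ {m′ μ} → μ ∈ partitionsInto as m′ → All (_< a) μ
  below {m′} {μ} μ∈ = All.map (ValidParts-below v) (proj₁ (proj₂ (partitionsInto-sound as m′ μ (ValidParts-tail v) μ∈)))
  disjointFor : ∀ e e′ → e ≢ e′ → Disjoint (withLeading a as m e) (withLeading a as m e′)
  disjointFor e e′ e≢e′ (x∈ , x∈′)
    with _ , μ∈ , refl ← ∈-map⁻ (replicate e a ++_) (proj₂ (∈-when≤⁻ {a = e * a} {m} _ x∈))
    with _ , μ′∈ , eq ← ∈-map⁻ (replicate e′ a ++_) (proj₂ (∈-when≤⁻ {a = e′ * a} {m} _ x∈′))
    = e≢e′ (replicate-++-injective a e e′ (below μ∈) (below μ′∈) eq)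

partitionsInto-∑ : ∀ a as m (w : List ℕ → ℕ) (h : ℕ → ℕ) →
  (∀ e m′ μ → μ ∈ partitionsInto as m′ → w (replicate e a ++ μ) ≡ h e * w μ) →
  sum (map w (partitionsInto (a ∷ as) m)) ≡ dilated⊛ h a (λ m′ → sum (map w (partitionsInto as m′))) m
partitionsInto-∑ a as m w h w-mult = begin
    sum (map w (concatMap (withLeading a as m) (upTo (suc m))))
  ≡⟨ sum-concatMap w (withLeading a as m) (upTo (suc m)) ⟩
    sum (map (λ e → sum (map w (withLeading a as m e))) (upTo (suc m)))
  ≡⟨ cong sum (map-applyUpTo id (λ e → sum (map w (withLeading a as m e))) (suc m)) ⟩
    ∑< (suc m) (λ e → sum (map w (withLeading a as m e)))
  ≡⟨ ∑<-cong (suc m) (λ e _ → trans (sum-when≤ w (e * a) m (map (replicate e a ++_) (partitionsInto as (m ∸ e * a))))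
                                    (cong ([ e * a ≤ m ]·_) (perLeading e))) ⟩
    dilated⊛ h a (λ m′ → sum (map w (partitionsInto as m′))) m
  ∎
  where
  open ≡-Reasoning
  perLeading : ∀ e → sum (map w (map (replicate e a ++_) (partitionsInto as (m ∸ e * a))))
                   ≡ h e * sum (map w (partitionsInto as (m ∸ e * a)))
  perLeading e = trans (cong sum (sym (map-∘ (partitionsInto as (m ∸ e * a)))))
    (trans (sum-map-cong (partitionsInto as (m ∸ e * a)) (w-mult e (m ∸ e * a) _))
      (sum-map-*ˡ (h e) w (partitionsInto as (m ∸ e * a))))

positivePowers : ℕ → ℕ → List ℕ
positivePowers D zero = []
positivePowers D (suc K) = D ^ suc K ∷ positivePowers D K

1≤D^j : ∀ D j → 1 ≤ D → 1 ≤ D ^ j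
1≤D^j D zero _ = ≤-refl
1≤D^j D (suc j) 1≤D = *-mono-≤ 1≤D (1≤D^j D j 1≤D)

2≤D^[1+j] : ∀ D j → 2 ≤ D → 2 ≤ D ^ suc j
2≤D^[1+j] D j 2≤D =
  ≤-trans 2≤D (subst (_≤ D * D ^ j) (*-identityʳ D) (*-monoʳ-≤ D (1≤D^j D j (≤-trans (s≤s z≤n) 2≤D))))

positivePowers-valid : ∀ D K → 2 ≤ D → ValidParts (positivePowers D K)
positivePowers-valid D zero _ = [] , []
positivePowers-valid D (suc K) 2≤D = decreasing K , 2≤D^[1+j] D K 2≤D ∷ proj₂ (positivePowers-valid D K 2≤D)
  where
  decreasing : ∀ K → Linked _>_ (positivePowers D (suc K))
  decreasing zero = [-]
  decreasing (suc K) = ^-monoʳ-< D 2≤D (n<1+n (suc K)) ∷ decreasing K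

∈-positivePowers⁻ : ∀ D K {x} → x ∈ positivePowers D K → ∃[ j ] (j < K × x ≡ D ^ suc j)
∈-positivePowers⁻ D (suc K) (here refl) = K , n<1+n K , refl
∈-positivePowers⁻ D (suc K) (there x∈) with j , j<K , eq ← ∈-positivePowers⁻ D K x∈ = j , <-trans j<K (n<1+n K) , eq

∈-positivePowers⁺ : ∀ D K j → j < K → D ^ suc j ∈ positivePowers D K
∈-positivePowers⁺ D (suc K) j j<1+K with j ≟ K
... | yes refl = here refl
... | no j≢K = there (∈-positivePowers⁺ D K j (≤∧≢⇒< (s≤s⁻¹ j<1+K) j≢K))

D-ary⇒IsPartitionInto : ∀ D K n λ′ → 2 ≤ D → n ≤ K → IsPartitionOf n λ′ → All (IsPowerOf D) λ′ →
                        IsPartitionInto (positivePowers D K) n λ′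
D-ary⇒IsPartitionInto D K n λ′ 2≤D n≤K (l , _ , Σλ′) powers = l , tabulate oneOrPositive , Σλ′
  where
  oneOrPositive : ∀ {x} → x ∈ λ′ → x ≡ 1 ⊎ x ∈ positivePowers D K
  oneOrPositive {x} x∈ with lookup powers x∈
  ... | zero , x≡1 = inj₁ x≡1
  ... | suc j , refl = inj₂ (∈-positivePowers⁺ D K j (<-≤-trans (n<1+n j) (<⇒≤ (<-≤-trans j<D^j
          (≤-trans (∈⇒≤sum x∈) (subst (_≤ K) (sym Σλ′) n≤K))))))
    where
    j<D^j : suc j < D ^ suc j
    j<D^j = <-≤-trans (n<2^n (suc j)) (^-monoˡ-≤ (suc j) 2≤D)

IsPartitionInto⇒D-ary : ∀ D K n λ′ → 2 ≤ D → IsPartitionInto (positivePowers D K) n λ′ →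
                        IsPartitionOf n λ′ × All (IsPowerOf D) λ′
IsPartitionInto⇒D-ary D K n λ′ 2≤D (l , parts , Σλ′) = (l , All.map positive parts , Σλ′) , All.map power parts
  where
  positive : ∀ {x} → x ≡ 1 ⊎ x ∈ positivePowers D K → 0 < x
  positive (inj₁ refl) = s≤s z≤n
  positive (inj₂ x∈) with j , _ , refl ← ∈-positivePowers⁻ D K x∈ = ≤-trans (s≤s z≤n) (2≤D^[1+j] D j 2≤D)
  power : ∀ {x} → x ≡ 1 ⊎ x ∈ positivePowers D K → IsPowerOf D x
  power (inj₁ refl) = 0 , refl
  power (inj₂ x∈) with j , _ , x≡ ← ∈-positivePowers⁻ D K x∈ = suc j , x≡

D-ary-enumeration : ∀ D n K → 2 ≤ D → n ≤ K → Enumeration (λ λ′ → IsPartitionOf n λ′ × All (IsPowerOf D) λ′)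
D-ary-enumeration D n K 2≤D n≤K = record
  { elems = partitionsInto (positivePowers D K) n
  ; unique = partitionsInto-unique (positivePowers D K) n (positivePowers-valid D K 2≤D)
  ; complete = λ λ′ → mk⇔
      (λ λ′∈ → IsPartitionInto⇒D-ary D K n λ′ 2≤D
                 (partitionsInto-sound _ n λ′ (positivePowers-valid D K 2≤D) λ′∈))
      (λ (partition , powers) → partitionsInto-complete _ n λ′ (positivePowers-valid D K 2≤D)
                                  (D-ary⇒IsPartitionInto D K n λ′ 2≤D n≤K partition powers))
  }

-- Multiplicities and pair products

mult-++ : ∀ i xs ys → mult i (xs ++ ys) ≡ mult i xs + mult i ys
mult-++ i xs ys = trans (cong length (filter-++ (i ≟_) xs ys)) (length-++ (filter (i ≟_) xs))

mult-↭ : ∀ i {xs ys} → xs ↭ ys → mult i xs ≡ mult i ys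
mult-↭ i xs↭ys = ↭.↭-length (↭.filter-↭ (i ≟_) xs↭ys)

mult-none : ∀ i {xs} → All (i ≢_) xs → mult i xs ≡ 0
mult-none i i∉xs = cong length (filter-none (i ≟_) i∉xs)

mult-replicate : ∀ i e → mult i (replicate e i) ≡ e
mult-replicate i zero = refl
mult-replicate i (suc e) = trans (cong length (filter-accept (i ≟_) refl)) (cong suc (mult-replicate i e))

mult-replicate-++ : ∀ i e a xs → i ≢ a → mult i (replicate e a ++ xs) ≡ mult i xs
mult-replicate-++ i e a xs i≢a = trans (mult-++ i (replicate e a) xs)
  (cong (_+ mult i xs) (mult-none i (All.replicate⁺ e i≢a)))

sorted-unique : ∀ {xs ys} → Linked _≥_ xs → Linked _≥_ ys → xs ↭ ys → xs ≡ ys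
sorted-unique xs↘ ys↘ xs↭ys = ≋⇒≡ (↗↭↗⇒≋ (Flip.totalOrder ≤-totalOrder) xs↘ ys↘ (↭⇒↭ₛ xs↭ys))

↭-cancelˡ : ∀ (xs : List ℕ) {ys zs} → xs ++ ys ↭ xs ++ zs → ys ↭ zs
↭-cancelˡ [] p = p
↭-cancelˡ (x ∷ xs) p = ↭-cancelˡ xs (↭.drop-∷ p)

pairProducts-↭ : ∀ {xs ys} → xs ↭ ys → pairProducts xs ↭ pairProducts ys
pairProducts-↭ Perm.refl = Perm.refl
pairProducts-↭ (Perm.prep x p) = ↭.++⁺ (↭.map⁺ (x *_) p) (pairProducts-↭ p)
pairProducts-↭ {x ∷ y ∷ xs} {.y ∷ .x ∷ ys} (Perm.swap x y p) =
  subst (λ z → x * y ∷ (map (x *_) xs ++ (map (y *_) xs ++ pairProducts xs))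
             ↭ z ∷ (map (y *_) ys ++ (map (x *_) ys ++ pairProducts ys)))
        (*-comm x y)
        (Perm.prep (x * y) (↭-trans (↭.++⁺ (↭.map⁺ (x *_) p) (↭.++⁺ (↭.map⁺ (y *_) p) (pairProducts-↭ p)))
                                    (↭.shifts (map (x *_) ys) (map (y *_) ys))))
pairProducts-↭ (Perm.trans p q) = ↭-trans (pairProducts-↭ p) (pairProducts-↭ q)

All-pairProducts : ∀ {P Q : ℕ → Set} xs → All P xs → (∀ {x y} → P x → P y → Q (x * y)) → All Q (pairProducts xs)
All-pairProducts [] [] _ = []
All-pairProducts (x ∷ xs) (px ∷ pxs) PP⇒Q =
  All.++⁺ (All.map⁺ (All.map (PP⇒Q px) pxs)) (All-pairProducts xs pxs PP⇒Q)

crossProducts : List ℕ → List ℕ → List ℕ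
crossProducts [] ρ = []
crossProducts (t ∷ T) ρ = map (t *_) ρ ++ crossProducts T ρ

-- the products of pairs from T ++ ρ that involve an element of ρ
newProducts : List ℕ → List ℕ → List ℕ
newProducts T ρ = crossProducts T ρ ++ pairProducts ρ

crossProducts-[] : ∀ T → crossProducts T [] ≡ []
crossProducts-[] [] = refl
crossProducts-[] (t ∷ T) = crossProducts-[] T

crossProducts-∷ : ∀ T x ρ → crossProducts T (x ∷ ρ) ↭ map (_* x) T ++ crossProducts T ρ
crossProducts-∷ [] x ρ = Perm.refl
crossProducts-∷ (t ∷ T) x ρ = Perm.prep (t * x) (↭-trans (↭.++⁺ˡ (map (t *_) ρ) (crossProducts-∷ T x ρ))
  (↭.shifts (map (t *_) ρ) (map (_* x) T)))

newProducts-∷ : ∀ T x ρ → newProducts T (x ∷ ρ) ↭ map (_* x) T ++ newProducts (x ∷ T) ρ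
newProducts-∷ T x ρ = begin
    crossProducts T (x ∷ ρ) ++ (map (x *_) ρ ++ pairProducts ρ)
  ↭⟨ ↭.++⁺ʳ _ (crossProducts-∷ T x ρ) ⟩
    (map (_* x) T ++ crossProducts T ρ) ++ (map (x *_) ρ ++ pairProducts ρ)
  ≡⟨ ++-assoc (map (_* x) T) (crossProducts T ρ) _ ⟩
    map (_* x) T ++ (crossProducts T ρ ++ (map (x *_) ρ ++ pairProducts ρ))
  ↭⟨ ↭.++⁺ˡ (map (_* x) T) (↭.shifts (crossProducts T ρ) (map (x *_) ρ)) ⟩
    map (_* x) T ++ (map (x *_) ρ ++ (crossProducts T ρ ++ pairProducts ρ))
  ≡⟨ cong (map (_* x) T ++_) (sym (++-assoc (map (x *_) ρ) (crossProducts T ρ) (pairProducts ρ))) ⟩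
    map (_* x) T ++ newProducts (x ∷ T) ρ
  ∎ where open Perm.PermutationReasoning

All-crossProducts : ∀ {P R Q : ℕ → Set} T ρ → All P T → All R ρ → (∀ {t r} → P t → R r → Q (t * r)) →
                    All Q (crossProducts T ρ)
All-crossProducts [] ρ [] _ _ = []
All-crossProducts (t ∷ T) ρ (pt ∷ pT) Rρ PR⇒Q =
  All.++⁺ (All.map⁺ (All.map (PR⇒Q pt) Rρ)) (All-crossProducts T ρ pT Rρ PR⇒Q)

≤-*-1≤ˡ : ∀ {t r y} → 1 ≤ t → y ≤ r → y ≤ t * r
≤-*-1≤ˡ {t} {r} 1≤t y≤r = ≤-trans y≤r (subst (_≤ t * r) (*-identityˡ r) (*-monoˡ-≤ r 1≤t))

≤-*-1≤ʳ : ∀ {t r y} → 1 ≤ r → y ≤ t → y ≤ t * r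
≤-*-1≤ʳ {t} {r} {y} 1≤r y≤t = subst (y ≤_) (*-comm r t) (≤-*-1≤ˡ 1≤r y≤t)

newProducts-lowerBound : ∀ T y ρ → All (1 ≤_) T → 1 ≤ y → Linked _≤_ (y ∷ ρ) → All (1 ≤_) ρ →
                         All (y ≤_) (newProducts T (y ∷ ρ))
newProducts-lowerBound T y ρ 1≤T 1≤y y≤ρ 1≤ρ = ↭.All-resp-↭ (↭-sym (newProducts-∷ T y ρ))
  (All.++⁺ (All.map⁺ (All.map (λ 1≤t → ≤-*-1≤ˡ 1≤t ≤-refl) 1≤T))
    (All.++⁺ (All-crossProducts (y ∷ T) ρ (1≤y ∷ 1≤T) y≤ρ′ ≤-*-1≤ˡ)
      (All-pairProducts ρ (All.zipWith id (y≤ρ′ , 1≤ρ)) (λ (y≤x , _) (_ , 1≤x′) → ≤-*-1≤ʳ 1≤x′ y≤x))))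
  where
  y≤ρ′ : All (y ≤_) ρ
  y≤ρ′ = headRelates ≤-trans y≤ρ

∈-newProducts : ∀ T x ρ → 1 ∈ T → x ∈ newProducts T (x ∷ ρ)
∈-newProducts T x ρ 1∈T = ↭.∈-resp-↭ (↭-sym (newProducts-∷ T x ρ))
  (∈-++⁺ˡ (subst (_∈ map (_* x) T) (+-identityʳ x) (∈-map⁺ (_* x) 1∈T)))

-- The least element of newProducts T (y ∷ ρ) is y = 1 · y; cancelling the products with y leaves newProducts (y ∷ T) ρ.
newProducts-injective : ∀ T ρ₁ ρ₂ → All (1 ≤_) T → 1 ∈ T →
                        Linked _≤_ ρ₁ → Linked _≤_ ρ₂ → All (1 ≤_) ρ₁ → All (1 ≤_) ρ₂ →
                        newProducts T ρ₁ ↭ newProducts T ρ₂ → ρ₁ ≡ ρ₂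
newProducts-injective T [] [] _ _ _ _ _ _ _ = refl
newProducts-injective T [] (y ∷ ρ₂) _ 1∈T _ _ _ _ p
  with y∈ ← ↭.∈-resp-↭ (↭-sym p) (∈-newProducts T y ρ₂ 1∈T) rewrite crossProducts-[] T with () ← y∈
newProducts-injective T (x ∷ ρ₁) [] _ 1∈T _ _ _ _ p
  with x∈ ← ↭.∈-resp-↭ p (∈-newProducts T x ρ₁ 1∈T) rewrite crossProducts-[] T with () ← x∈
newProducts-injective T (x ∷ ρ₁) (y ∷ ρ₂) 1≤T 1∈T l₁ l₂ (1≤x ∷ 1≤ρ₁) (1≤y ∷ 1≤ρ₂) p
  with refl ← ≤-antisym
    (lookup (newProducts-lowerBound T x ρ₁ 1≤T 1≤x l₁ 1≤ρ₁) (↭.∈-resp-↭ (↭-sym p) (∈-newProducts T y ρ₂ 1∈T)))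
    (lookup (newProducts-lowerBound T y ρ₂ 1≤T 1≤y l₂ 1≤ρ₂) (↭.∈-resp-↭ p (∈-newProducts T x ρ₁ 1∈T)))
  = cong (x ∷_) (newProducts-injective (x ∷ T) ρ₁ ρ₂ (1≤x ∷ 1≤T) (there 1∈T)
      (Linked.tail l₁) (Linked.tail l₂) 1≤ρ₁ 1≤ρ₂
      (↭-cancelˡ (map (_* x) T) (↭-trans (↭-sym (newProducts-∷ T x ρ₁)) (↭-trans p (newProducts-∷ T x ρ₂)))))

module ↑ = Sort ≤-decTotalOrder

module ↓ = Sort (Flip.decTotalOrder ≤-decTotalOrder)

sort↑-starts-with-1 : ∀ λ′ → All (1 ≤_) λ′ → 1 ∈ λ′ →
                      ∃[ ρ ] (↑.sort λ′ ≡ 1 ∷ ρ × All (1 ≤_) ρ × Linked _≤_ ρ)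
sort↑-starts-with-1 λ′ 1≤λ′ 1∈λ′ with ↑.sort λ′ | ↑.sort-↭ λ′ | ↑.sort-↗ λ′
... | [] | p | _ with () ← ↭.∈-resp-↭ (↭-sym p) 1∈λ′
... | h ∷ ρ | p | l with ↭.All-resp-↭ (↭-sym p) 1≤λ′ | ↭.∈-resp-↭ (↭-sym p) 1∈λ′
...   | _ ∷ 1≤ρ | here refl = ρ , refl , 1≤ρ , Linked.tail l
...   | 1≤h ∷ 1≤ρ | there 1∈ρ with refl ← ≤-antisym (lookup (headRelates ≤-trans l) 1∈ρ) 1≤h =
  ρ , refl , 1≤ρ , Linked.tail l

pairProducts-injective : ∀ λ₁ λ₂ → Linked _≥_ λ₁ → Linked _≥_ λ₂ → All (1 ≤_) λ₁ → All (1 ≤_) λ₂ →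
                         1 ∈ λ₁ → 1 ∈ λ₂ →
                         pairProducts λ₁ ↭ pairProducts λ₂ → λ₁ ≡ λ₂
pairProducts-injective λ₁ λ₂ λ₁↘ λ₂↘ 1≤λ₁ 1≤λ₂ 1∈λ₁ 1∈λ₂ p
  with ρ₁ , sort≡₁ , 1≤ρ₁ , ρ₁↗ ← sort↑-starts-with-1 λ₁ 1≤λ₁ 1∈λ₁
     | ρ₂ , sort≡₂ , 1≤ρ₂ , ρ₂↗ ← sort↑-starts-with-1 λ₂ 1≤λ₂ 1∈λ₂
  = sorted-unique λ₁↘ λ₂↘ λ₁↭λ₂
  where
  viaSort : ∀ λ′ {ρ} → ↑.sort λ′ ≡ 1 ∷ ρ → pairProducts λ′ ↭ newProducts [ 1 ] ρ
  viaSort λ′ {ρ} sort≡ = subst (pairProducts λ′ ↭_) (cong (_++ pairProducts ρ) (sym (++-identityʳ (map (1 *_) ρ))))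
    (subst (λ μ → pairProducts λ′ ↭ pairProducts μ) sort≡ (pairProducts-↭ (↭-sym (↑.sort-↭ λ′))))
  ρ₁≡ρ₂ : ρ₁ ≡ ρ₂
  ρ₁≡ρ₂ = newProducts-injective [ 1 ] ρ₁ ρ₂ (≤-refl ∷ []) (here refl) ρ₁↗ ρ₂↗ 1≤ρ₁ 1≤ρ₂
            (↭-trans (↭-sym (viaSort λ₁ sort≡₁)) (↭-trans p (viaSort λ₂ sort≡₂)))
  λ₁↭λ₂ : λ₁ ↭ λ₂
  λ₁↭λ₂ = ↭-trans (↭-sym (↑.sort-↭ λ₁))
            (subst (_↭ λ₂) (trans sort≡₂ (trans (cong (1 ∷_) (sym ρ₁≡ρ₂)) (sym sort≡₁))) (↑.sort-↭ λ₂))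

onesInPairProducts : List ℕ → ℕ
onesInPairProducts λ′ = mult 1 (pairProducts λ′)

onesInPairProducts-≥2 : ∀ λ′ → All (2 ≤_) λ′ → onesInPairProducts λ′ ≡ 0
onesInPairProducts-≥2 λ′ 2≤λ′ = mult-none 1 (All-pairProducts λ′ 2≤λ′
  (λ 2≤x 2≤y 1≡xy → <-irrefl 1≡xy (≤-*-1≤ˡ (≤-trans (s≤s z≤n) 2≤x) 2≤y)))

∈-or-≥2 : ∀ λ′ → All (1 ≤_) λ′ → 1 ∈ λ′ ⊎ All (2 ≤_) λ′
∈-or-≥2 [] [] = inj₂ []
∈-or-≥2 (x ∷ λ′) (1≤x ∷ 1≤λ′) with x ≟ 1 | ∈-or-≥2 λ′ 1≤λ′
... | yes refl | _ = inj₁ (here refl)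
... | no _ | inj₁ 1∈λ′ = inj₁ (there 1∈λ′)
... | no x≢1 | inj₂ 2≤λ′ = inj₂ (≤∧≢⇒< 1≤x (x≢1 ∘ sym) ∷ 2≤λ′)

onesInPairProducts-pos⇒1∈ : ∀ λ′ → All (1 ≤_) λ′ → 1 ≤ onesInPairProducts λ′ → 1 ∈ λ′
onesInPairProducts-pos⇒1∈ λ′ 1≤λ′ pos with ∈-or-≥2 λ′ 1≤λ′
... | inj₁ 1∈λ′ = 1∈λ′
... | inj₂ 2≤λ′ = ⊥-elim (<-irrefl (sym (onesInPairProducts-≥2 λ′ 2≤λ′)) pos)

onesInPairProducts-pos⇒2≤length : ∀ λ′ → 1 ≤ onesInPairProducts λ′ → 2 ≤ length λ′
onesInPairProducts-pos⇒2≤length (x ∷ y ∷ λ′) _ = s≤s (s≤s z≤n)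

onesInPairProducts-replicate-++ : ∀ e a λ′ → 2 ≤ a → All (1 ≤_) λ′ →
                                  onesInPairProducts (replicate e a ++ λ′) ≡ onesInPairProducts λ′
onesInPairProducts-replicate-++ zero a λ′ _ _ = refl
onesInPairProducts-replicate-++ (suc e) a λ′ 2≤a 1≤λ′ =
  trans (trans (mult-++ 1 (map (a *_) μ) (pairProducts μ))
               (cong (_+ onesInPairProducts μ) (mult-none 1 (All.map⁺ (All.map a*≢1 1≤μ)))))
        (onesInPairProducts-replicate-++ e a λ′ 2≤a 1≤λ′)
  where
  μ : List ℕ
  μ = replicate e a ++ λ′
  1≤μ : All (1 ≤_) μ
  1≤μ = All.++⁺ (All.replicate⁺ e (≤-trans (s≤s z≤n) 2≤a)) 1≤λ′
  a*≢1 : ∀ {x} → 1 ≤ x → 1 ≢ a * x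
  a*≢1 1≤x 1≡ax = <-irrefl 1≡ax (≤-*-1≤ʳ 1≤x 2≤a)

onesInPairProducts-ones : ∀ m → onesInPairProducts (replicate m 1) ≡ m C 2
onesInPairProducts-ones zero = refl
onesInPairProducts-ones (suc m) = begin
    mult 1 (map (1 *_) (replicate m 1) ++ pairProducts (replicate m 1))
  ≡⟨ mult-++ 1 (map (1 *_) (replicate m 1)) (pairProducts (replicate m 1)) ⟩
    mult 1 (map (1 *_) (replicate m 1)) + onesInPairProducts (replicate m 1)
  ≡⟨ cong₂ _+_ (trans (cong (mult 1) (map-replicate (1 *_) m 1)) (trans (mult-replicate 1 m) (sym (nC1≡n m))))
               (onesInPairProducts-ones m) ⟩
    m C 1 + m C 2
  ≡⟨ nCk+nC[k+1]≡[n+1]C[k+1] m 1 ⟩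
    suc m C 2
  ∎ where open ≡-Reasoning

-- Ones in the images of pre₂

module _ (D : ℕ) (2≤D : 2 ≤ D) where

  onesSum : ℕ → PS
  onesSum K m = sum (map onesInPairProducts (partitionsInto (positivePowers D K) m))

  onesSum≗onesGF : ∀ K → onesSum K ≗ onesGF D K
  onesSum≗onesGF zero m = trans (+-identityʳ _) (trans (onesInPairProducts-ones m) (sym (choose2Series-coeff m)))
  onesSum≗onesGF (suc K) m = begin
      onesSum (suc K) m
    ≡⟨ partitionsInto-∑ (D ^ suc K) (positivePowers D K) m onesInPairProducts (λ _ → 1) dropsOut ⟩
      dilated⊛ (λ _ → 1) (D ^ suc K) (onesSum K) m
    ≡⟨ dilated⊛≗dilate-⊛ (λ _ → 1) (D ^ suc K) (onesSum K) (≤-trans (s≤s z≤n) (2≤D^[1+j] D K 2≤D)) m ⟩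
      (geom (D ^ suc K) ⊛ onesSum K) m
    ≡⟨ ⊛-cong (≗-refl {geom (D ^ suc K)}) (onesSum≗onesGF K) m ⟩
      onesGF D (suc K) m
    ∎
    where
    open ≡-Reasoning
    dropsOut : ∀ e m′ μ → μ ∈ partitionsInto (positivePowers D K) m′ →
               onesInPairProducts (replicate e (D ^ suc K) ++ μ) ≡ 1 * onesInPairProducts μ
    dropsOut e m′ μ μ∈ = trans (onesInPairProducts-replicate-++ e (D ^ suc K) μ (2≤D^[1+j] D K 2≤D)
        (proj₁ (proj₂ (proj₁ (IsPartitionInto⇒D-ary D K m′ μ 2≤D
          (partitionsInto-sound (positivePowers D K) m′ μ (positivePowers-valid D K 2≤D) μ∈))))))
      (sym (*-identityˡ _))

  pre₂ : List ℕ → List ℕ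
  pre₂ λ′ = ↓.sort (pairProducts λ′)

  pre₂-↭ : ∀ λ′ → pre₂ λ′ ↭ pairProducts λ′
  pre₂-↭ λ′ = ↓.sort-↭ (pairProducts λ′)

  module _ (n K : ℕ) (n≤K : n ≤ K) where

    private
      withOnes? : Decidable (λ λ′ → 1 ≤ onesInPairProducts λ′)
      withOnes? λ′ = 1 ≤? onesInPairProducts λ′

      withOnes : List (List ℕ)
      withOnes = filter withOnes? (partitionsInto (positivePowers D K) n)

      ∈-withOnes⁻ : ∀ {λ′} → λ′ ∈ withOnes →
                    (IsPartitionOf n λ′ × All (IsPowerOf D) λ′) × 1 ≤ onesInPairProducts λ′
      ∈-withOnes⁻ {λ′} λ′∈
        with λ′∈L , pos ← ∈-filter⁻ withOnes? {xs = partitionsInto (positivePowers D K) n} λ′∈ =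
        IsPartitionInto⇒D-ary D K n λ′ 2≤D
          (partitionsInto-sound (positivePowers D K) n λ′ (positivePowers-valid D K 2≤D) λ′∈L) , pos

      injective : ∀ {λ₁ λ₂} → λ₁ ∈ withOnes → λ₂ ∈ withOnes → pre₂ λ₁ ≡ pre₂ λ₂ → λ₁ ≡ λ₂
      injective {λ₁} {λ₂} λ₁∈ λ₂∈ pre₂≡
        with ((l₁ , pos₁ , _) , _) , ones₁ ← ∈-withOnes⁻ λ₁∈
           | ((l₂ , pos₂ , _) , _) , ones₂ ← ∈-withOnes⁻ λ₂∈
        = pairProducts-injective λ₁ λ₂ l₁ l₂ pos₁ pos₂
            (onesInPairProducts-pos⇒1∈ λ₁ pos₁ ones₁) (onesInPairProducts-pos⇒1∈ λ₂ pos₂ ones₂)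
            (↭-trans (↭-sym (pre₂-↭ λ₁)) (subst (_↭ pairProducts λ₂) (sym pre₂≡) (pre₂-↭ λ₂)))

      sound : ∀ μ → μ ∈ map pre₂ withOnes → ImP₂ n D μ × 1 ≤ mult 1 μ
      sound μ μ∈ with λ′ , λ′∈ , refl ← ∈-map⁻ pre₂ μ∈ with (partition , powers) , ones ← ∈-withOnes⁻ λ′∈ =
        (↓.sort-↗ (pairProducts λ′) ,
         λ′ , (partition , powers , onesInPairProducts-pos⇒2≤length λ′ ones) , pre₂-↭ λ′) ,
        subst (1 ≤_) (sym (mult-↭ 1 (pre₂-↭ λ′))) ones

      complete′ : ∀ μ → ImP₂ n D μ × 1 ≤ mult 1 μ → μ ∈ map pre₂ withOnes
      complete′ μ ((μ↘ , λ′ , (partition , powers , _) , μ↭) , ones) =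
        subst (_∈ map pre₂ withOnes) pre₂≡μ (∈-map⁺ pre₂ λ′∈)
        where
        λ′∈ : λ′ ∈ withOnes
        λ′∈ = ∈-filter⁺ withOnes? (partitionsInto-complete (positivePowers D K) n λ′ (positivePowers-valid D K 2≤D)
                                     (D-ary⇒IsPartitionInto D K n λ′ 2≤D n≤K partition powers))
                        (subst (1 ≤_) (mult-↭ 1 μ↭) ones)
        pre₂≡μ : pre₂ λ′ ≡ μ
        pre₂≡μ = sorted-unique (↓.sort-↗ (pairProducts λ′)) μ↘ (↭-trans (pre₂-↭ λ′) (↭-sym μ↭))

    pre₂-enumeration : Enumeration (λ μ → ImP₂ n D μ × 1 ≤ mult 1 μ)
    pre₂-enumeration = record
      { elems = map pre₂ withOnes
      ; unique = Unique-map⁺-injectiveOn pre₂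
                   (Unique.filter⁺ withOnes? (partitionsInto-unique (positivePowers D K) n (positivePowers-valid D K 2≤D)))
                   injective
      ; complete = λ μ → mk⇔ (sound μ) (complete′ μ)
      }

    ones-ImP₂ : (E : Enumeration (ImP₂ n D)) → sum (map (mult 1) (elems E)) ≡ onesSum K n
    ones-ImP₂ E = begin
        sum (map (mult 1) (elems E))
      ≡⟨ sym (sum-filter-nonzero (mult 1) (elems E)) ⟩
        sum (map (mult 1) (elems (filterEnumeration E (λ μ → 1 ≤? mult 1 μ))))
      ≡⟨ Enumeration-sum (mult 1) (filterEnumeration E (λ μ → 1 ≤? mult 1 μ)) pre₂-enumeration ⟩
        sum (map (mult 1) (map pre₂ withOnes))
      ≡⟨ cong sum (sym (map-∘ withOnes)) ⟩
        sum (map (mult 1 ∘ pre₂) withOnes)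
      ≡⟨ cong sum (map-cong (λ λ′ → mult-↭ 1 (pre₂-↭ λ′)) withOnes) ⟩
        sum (map onesInPairProducts withOnes)
      ≡⟨ sum-filter-nonzero onesInPairProducts (partitionsInto (positivePowers D K) n) ⟩
        onesSum K n
      ∎ where open ≡-Reasoning

-- Sets of coloured parts

sublists : ∀ {A : Set} → List A → List (List A)
sublists [] = [] ∷ []
sublists (x ∷ xs) = map (x ∷_) (sublists xs) ++ sublists xs

module _ {A : Set} {_≻_ : Rel A 0ℓ} (≻-trans : Transitive _≻_) (≻-irrefl : ∀ {x} → ¬ x ≻ x) where

  private
    ∈-∷⁻ : ∀ {x z xs} → x ≻ z → z ∈ x ∷ xs → z ∈ xs
    ∈-∷⁻ x≻x (here refl) = ⊥-elim (≻-irrefl x≻x)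
    ∈-∷⁻ _ (there z∈xs) = z∈xs

  sublists-sound : ∀ S s → Linked _≻_ S → s ∈ sublists S → Linked _≻_ s × All (_∈ S) s
  sublists-sound [] .[] _ (here refl) = [] , []
  sublists-sound (x ∷ xs) s l s∈ with ∈-++⁻ (map (x ∷_) (sublists xs)) s∈
  ... | inj₁ s∈map with s′ , s′∈ , refl ← ∈-map⁻ (x ∷_) s∈map
                  with l′ , s′⊆xs ← sublists-sound xs s′ (Linked.tail l) s′∈
    = linked-∷ (All.map (lookup (headRelates ≻-trans l)) s′⊆xs) l′ , here refl ∷ All.map there s′⊆xs
  ... | inj₂ s∈rest with l′ , s⊆xs ← sublists-sound xs s (Linked.tail l) s∈rest = l′ , All.map there s⊆xs

  sublists-complete : ∀ S s → Linked _≻_ S → Linked _≻_ s → All (_∈ S) s → s ∈ sublists S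
  sublists-complete [] [] _ _ _ = here refl
  sublists-complete [] (_ ∷ _) _ _ (() ∷ _)
  sublists-complete (x ∷ xs) [] l _ _ = ∈-++⁺ʳ (map (x ∷_) (sublists xs)) (sublists-complete xs [] (Linked.tail l) [] [])
  sublists-complete (x ∷ xs) (.x ∷ s) l ls (here refl ∷ s⊆) =
    ∈-++⁺ˡ (∈-map⁺ (x ∷_) (sublists-complete xs s (Linked.tail l) (Linked.tail ls)
      (All.zipWith (λ (z∈ , x≻z) → ∈-∷⁻ x≻z z∈) (s⊆ , headRelates ≻-trans ls))))
  sublists-complete (x ∷ xs) (y ∷ s) l ls (there y∈xs ∷ s⊆) =
    ∈-++⁺ʳ (map (x ∷_) (sublists xs)) (sublists-complete xs (y ∷ s) (Linked.tail l) ls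
      (y∈xs ∷ All.zipWith (λ (z∈ , y≻z) → ∈-∷⁻ (≻-trans x≻y y≻z) z∈) (s⊆ , headRelates ≻-trans ls)))
    where
    x≻y : x ≻ y
    x≻y = lookup (headRelates ≻-trans l) y∈xs

  sublists-unique : ∀ S → Linked _≻_ S → Unique (sublists S)
  sublists-unique [] _ = [] ∷ []
  sublists-unique (x ∷ xs) l =
    Unique.++⁺ (Unique.map⁺ ∷-injectiveʳ (sublists-unique xs (Linked.tail l))) (sublists-unique xs (Linked.tail l)) disjoint
    where
    disjoint : ∀ {s} → ¬ (s ∈ map (x ∷_) (sublists xs) × s ∈ sublists xs)
    disjoint (s∈map , s∈)
      with s′ , _ , refl ← ∈-map⁻ (x ∷_) s∈map
      with _ , x∈xs ∷ _ ← sublists-sound xs (x ∷ s′) (Linked.tail l) s∈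
      = ≻-irrefl (lookup (headRelates ≻-trans l) x∈xs)

>ₗ-trans : Transitive _>ₗ_
>ₗ-trans (inj₁ p) (inj₁ q) = inj₁ (<-trans q p)
>ₗ-trans (inj₁ p) (inj₂ (refl , _)) = inj₁ p
>ₗ-trans (inj₂ (refl , _)) (inj₁ q) = inj₁ q
>ₗ-trans (inj₂ (refl , p)) (inj₂ (refl , q)) = inj₂ (refl , <-trans q p)

>ₗ-irrefl : ∀ {x} → ¬ x >ₗ x
>ₗ-irrefl (inj₁ t<t) = <-irrefl refl t<t
>ₗ-irrefl (inj₂ (_ , c<c)) = <-irrefl refl c<c

size : List ColouredPart → ℕ
size s = sum (map partSize s)

sizeGF : List ColouredPart → PS
sizeGF L n = sum (map (λ s → qPow n (size s)) (sublists L))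

sizeGF-[] : sizeGF [] ≗ oneS
sizeGF-[] zero = refl
sizeGF-[] (suc n) = refl

sizeGF-∷ : ∀ x L → sizeGF (x ∷ L) ≗ 1+q^ (partSize x) ⊛ sizeGF L
sizeGF-∷ x L n = begin
    sum (map f (map (x ∷_) (sublists L) ++ sublists L))
  ≡⟨ cong sum (map-++ f (map (x ∷_) (sublists L)) (sublists L)) ⟩
    sum (map f (map (x ∷_) (sublists L)) ++ map f (sublists L))
  ≡⟨ sum-++ (map f (map (x ∷_) (sublists L))) (map f (sublists L)) ⟩
    sum (map f (map (x ∷_) (sublists L))) + sizeGF L n
  ≡⟨ cong (_+ sizeGF L n) (cong sum (sym (map-∘ (sublists L)))) ⟩
    sum (map (λ s → qPow n (w + size s)) (sublists L)) + sizeGF L n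
  ≡⟨ cong (_+ sizeGF L n) (cong sum (map-cong (λ s → qPow-+ w (size s) n) (sublists L))) ⟩
    sum (map (λ s → [ w ≤ n ]· qPow (n ∸ w) (size s)) (sublists L)) + sizeGF L n
  ≡⟨ cong (_+ sizeGF L n) (sum-map-[≤]· w n (λ s → qPow (n ∸ w) (size s)) (sublists L)) ⟩
    [ w ≤ n ]· sizeGF L (n ∸ w) + sizeGF L n
  ≡⟨ +-comm _ (sizeGF L n) ⟩
    sizeGF L n + [ w ≤ n ]· sizeGF L (n ∸ w)
  ≡⟨ sym (1+q^-⊛ w (sizeGF L) n) ⟩
    (1+q^ w ⊛ sizeGF L) n
  ∎ where
    open ≡-Reasoning
    w : ℕ
    w = partSize x
    f : List ColouredPart → ℕ
    f s = qPow n (size s)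

length-filter-size : ∀ n xs → length (filter (λ s → size s ≟ n) xs) ≡ sum (map (λ s → qPow n (size s)) xs)
length-filter-size n [] = refl
length-filter-size n (x ∷ xs) with does (size x ≟ n)
... | true = cong suc (length-filter-size n xs)
... | false = length-filter-size n xs

colouredCopies : ℕ → ℕ → List ColouredPart
colouredCopies t k = map (t ,_) (downFrom k)

sizeGF-colouredCopies-++ : ∀ t k L → sizeGF (colouredCopies t k ++ L) ≗ powS (1+q^ (2 ^ t)) k ⊛ sizeGF L
sizeGF-colouredCopies-++ t zero L = ≗-sym (⊛-identityˡ (sizeGF L))
sizeGF-colouredCopies-++ t (suc k) L = ≗-trans (sizeGF-∷ (t , k) (colouredCopies t k ++ L))
  (≗-trans (⊛-cong (≗-refl {1+q^ (2 ^ t)}) (sizeGF-colouredCopies-++ t k L))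
           (≗-sym (⊛-assoc (1+q^ (2 ^ t)) (powS (1+q^ (2 ^ t)) k) (sizeGF L))))

∈-colouredCopies⁻ : ∀ t k {x} → x ∈ colouredCopies t k → proj₁ x ≡ t × proj₂ x < k
∈-colouredCopies⁻ t k x∈ with c , c∈ , refl ← ∈-map⁻ (t ,_) x∈ = refl , ∈-downFrom⁻ c∈

colouredCopies-decreasing : ∀ t k → Linked _>ₗ_ (colouredCopies t k)
colouredCopies-decreasing t zero = []
colouredCopies-decreasing t (suc zero) = [-]
colouredCopies-decreasing t (suc (suc k)) = inj₂ (refl , ≤-refl) ∷ colouredCopies-decreasing t (suc k)

size-bound : ∀ n s → size s ≡ n → ∀ {x} → x ∈ s → proj₁ x < suc n
size-bound n s size≡n {t , c} x∈ =
  s≤s (<⇒≤ (<-≤-trans (n<2^n t) (subst (2 ^ t ≤_) size≡n (∈⇒≤sum (∈-map⁺ partSize x∈)))))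

module _ (d : ℕ) .{{_ : NonZero d}} where

  colouredParts : ℕ → List ColouredPart
  colouredParts zero = []
  colouredParts (suc N) = colouredCopies N (nColours d N) ++ colouredParts N

  sizeGF-colouredParts : ∀ N → sizeGF (colouredParts N) ≗ partialProduct d N
  sizeGF-colouredParts zero = sizeGF-[]
  sizeGF-colouredParts (suc N) = ≗-trans (sizeGF-colouredCopies-++ N (nColours d N) (colouredParts N))
    (≗-trans (⊛-cong (≗-refl {factor d N}) (sizeGF-colouredParts N)) (⊛-comm (factor d N) (partialProduct d N)))

  ∈-colouredParts⁻ : ∀ N {x} → x ∈ colouredParts N → proj₁ x < N × ValidColour d x
  ∈-colouredParts⁻ (suc N) x∈ with ∈-++⁻ (colouredCopies N (nColours d N)) x∈
  ... | inj₁ x∈copies with refl , c<k ← ∈-colouredCopies⁻ N (nColours d N) x∈copies = n<1+n N , c<k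
  ... | inj₂ x∈parts with t<N , valid ← ∈-colouredParts⁻ N x∈parts = <-trans t<N (n<1+n N) , valid

  ∈-colouredParts⁺ : ∀ N t c → t < N → ValidColour d (t , c) → (t , c) ∈ colouredParts N
  ∈-colouredParts⁺ (suc N) t c t<1+N valid with t ≟ N
  ... | yes refl = ∈-++⁺ˡ (∈-map⁺ (t ,_) (∈-downFrom⁺ valid))
  ... | no t≢N =
    ∈-++⁺ʳ (colouredCopies N (nColours d N)) (∈-colouredParts⁺ N t c (≤∧≢⇒< (s≤s⁻¹ t<1+N) t≢N) valid)

  colouredParts-decreasing : ∀ N → Linked _>ₗ_ (colouredParts N)
  colouredParts-decreasing zero = []
  colouredParts-decreasing (suc N) =
    linked-++ >ₗ-trans (colouredCopies N (nColours d N)) (colouredCopies-decreasing N (nColours d N)) (colouredParts-decreasing N)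
      (tabulate (λ x∈ → tabulate (λ y∈ → inj₁ (subst (_ <_) (sym (proj₁ (∈-colouredCopies⁻ N (nColours d N) x∈)))
                                                         (proj₁ (∈-colouredParts⁻ N y∈))))))

  sublistsOfSize : ℕ → List (List ColouredPart)
  sublistsOfSize n = filter (λ s → size s ≟ n) (sublists (colouredParts (suc n)))

  Q-enumeration : ∀ n → Enumeration (Q d n)
  Q-enumeration n = record
    { elems = sublistsOfSize n
    ; unique = Unique.filter⁺ (λ s → size s ≟ n) (sublists-unique >ₗ-trans >ₗ-irrefl _ decreasing)
    ; complete = λ s → mk⇔ (sound s) (complete′ s)
    }
    where
    decreasing : Linked _>ₗ_ (colouredParts (suc n))
    decreasing = colouredParts-decreasing (suc n)
    sound : ∀ s → s ∈ sublistsOfSize n → Q d n s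
    sound s s∈ with s∈sub , size≡n ← ∈-filter⁻ (λ s → size s ≟ n) {xs = sublists (colouredParts (suc n))} s∈
               with l , s⊆ ← sublists-sound >ₗ-trans >ₗ-irrefl _ s decreasing s∈sub
      = l , All.map (λ x∈ → proj₂ (∈-colouredParts⁻ (suc n) x∈)) s⊆ , size≡n
    complete′ : ∀ s → Q d n s → s ∈ sublistsOfSize n
    complete′ s (l , valid , size≡n) = ∈-filter⁺ (λ s → size s ≟ n)
      (sublists-complete >ₗ-trans >ₗ-irrefl _ s decreasing l
        (tabulate (λ {x} x∈ → ∈-colouredParts⁺ (suc n) (proj₁ x) (proj₂ x) (size-bound n s size≡n x∈) (lookup valid x∈))))
      size≡n

  Q-count : ∀ n (F : Enumeration (Q d n)) → length (elems F) ≡ partialProduct d (suc n) n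
  Q-count n F = begin
      length (elems F)
    ≡⟨ ↭.↭-length (Enumeration-↭ F (Q-enumeration n)) ⟩
      length (sublistsOfSize n)
    ≡⟨ length-filter-size n (sublists (colouredParts (suc n))) ⟩
      sizeGF (colouredParts (suc n)) n
    ≡⟨ sizeGF-colouredParts (suc n) n ⟩
      partialProduct d (suc n) n
    ∎ where open ≡-Reasoning

-- Binomial weights of binary partitions

∏< : ℕ → (ℕ → ℕ) → ℕ
∏< M f = foldr _*_ 1 (applyUpTo f M)

∏<-cong : ∀ M {f g} → f ≗ g → ∏< M f ≡ ∏< M g
∏<-cong zero f≗g = refl
∏<-cong (suc M) f≗g = cong₂ _*_ (f≗g 0) (∏<-cong M (f≗g ∘ suc))

∏<-ones : ∀ M → ∏< M (λ _ → 1) ≡ 1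
∏<-ones zero = refl
∏<-ones (suc M) = trans (+-identityʳ _) (∏<-ones M)

dropFactor : ℕ → (ℕ → ℕ) → ℕ → ℕ
dropFactor K f i = if does (i ≟ K) then 1 else f i

dropFactor-cong : ∀ K f g → (∀ i → i ≢ K → f i ≡ g i) → dropFactor K f ≗ dropFactor K g
dropFactor-cong K f g f≡g i with i ≟ K
... | yes i≡K rewrite dec-true (i ≟ K) i≡K = refl
... | no i≢K rewrite dec-false (i ≟ K) i≢K = f≡g i i≢K

∏<-extract : ∀ M K f → K < M → ∏< M f ≡ f K * ∏< M (dropFactor K f)
∏<-extract (suc M) zero f _ = cong (f 0 *_) (sym (+-identityʳ _))
∏<-extract (suc M) (suc K) f (s≤s K<M) = begin
    f 0 * ∏< M (f ∘ suc)
  ≡⟨ cong (f 0 *_) (∏<-extract M K (f ∘ suc) K<M) ⟩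
    f 0 * (f (suc K) * ∏< M (dropFactor K (f ∘ suc)))
  ≡⟨ x∙yz≈y∙xz (f 0) (f (suc K)) _ ⟩
    f (suc K) * (f 0 * ∏< M (dropFactor K (f ∘ suc)))
  ∎ where open ≡-Reasoning

2^-injective : ∀ {i j} → 2 ^ i ≡ 2 ^ j → i ≡ j
2^-injective {i} {j} 2^i≡2^j with <-cmp i j
... | tri< i<j _ _ = ⊥-elim (<-irrefl 2^i≡2^j (^-monoʳ-< 2 ≤-refl i<j))
... | tri≈ _ i≡j _ = i≡j
... | tri> _ _ j<i = ⊥-elim (<-irrefl (sym 2^i≡2^j) (^-monoʳ-< 2 ≤-refl j<i))

module _ (d : ℕ) .{{_ : NonZero d}} where

  binomialWeight : ℕ → List ℕ → ℕ
  binomialWeight M λ′ = ∏< M (λ i → nColours d i C mult (2 ^ i) λ′)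

  binomialWeight-replicate-++ : ∀ M K e μ → suc K < M → All (_< 2 ^ suc K) μ →
    binomialWeight M (replicate e (2 ^ suc K) ++ μ) ≡ (nColours d (suc K) C e) * binomialWeight M μ
  binomialWeight-replicate-++ M K e μ K<M μ<a = begin
      ∏< M (F λ′)
    ≡⟨ ∏<-extract M (suc K) (F λ′) K<M ⟩
      F λ′ (suc K) * ∏< M (dropFactor (suc K) (F λ′))
    ≡⟨ cong₂ _*_ (cong (c C_) (trans (mult-++ a (replicate e a) μ)
                   (trans (cong₂ _+_ (mult-replicate a e) a∉μ) (+-identityʳ e))))
                 (∏<-cong M (dropFactor-cong (suc K) (F λ′) (F μ) otherFactors)) ⟩
      (c C e) * ∏< M (dropFactor (suc K) (F μ))
    ≡⟨ cong ((c C e) *_) (sym (trans (∏<-extract M (suc K) (F μ) K<M)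
                                (trans (cong (λ k → (c C k) * ∏< M (dropFactor (suc K) (F μ))) a∉μ) (*-identityˡ _)))) ⟩
      (c C e) * ∏< M (F μ)
    ∎
    where
    open ≡-Reasoning
    a c : ℕ
    a = 2 ^ suc K
    c = nColours d (suc K)
    λ′ : List ℕ
    λ′ = replicate e a ++ μ
    F : List ℕ → ℕ → ℕ
    F l i = nColours d i C mult (2 ^ i) l
    a∉μ : mult a μ ≡ 0
    a∉μ = mult-none a (All.map (λ x<a a≡x → <-irrefl (sym a≡x) x<a) μ<a)
    otherFactors : ∀ i → i ≢ suc K → F λ′ i ≡ F μ i
    otherFactors i i≢K = cong (nColours d i C_) (mult-replicate-++ (2 ^ i) e a μ (i≢K ∘ 2^-injective))

  binomialWeight-ones : ∀ M m → 0 < M → binomialWeight M (replicate m 1) ≡ nColours d 0 C m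
  binomialWeight-ones M m 0<M = begin
      ∏< M F
    ≡⟨ ∏<-extract M 0 F 0<M ⟩
      F 0 * ∏< M (dropFactor 0 F)
    ≡⟨ cong₂ _*_ (cong (nColours d 0 C_) (mult-replicate 1 m)) (trans (∏<-cong M otherFactors) (∏<-ones M)) ⟩
      (nColours d 0 C m) * 1
    ≡⟨ *-identityʳ _ ⟩
      nColours d 0 C m
    ∎
    where
    open ≡-Reasoning
    F : ℕ → ℕ
    F i = nColours d i C mult (2 ^ i) (replicate m 1)
    otherFactors : ∀ i → dropFactor 0 F i ≡ 1
    otherFactors zero = refl
    otherFactors (suc i) = cong (nColours d (suc i) C_)
      (mult-none (2 ^ suc i) (All.replicate⁺ m (λ 2^i≡1 → 0≢1+n (2^-injective {0} {suc i} (sym 2^i≡1)))))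

  binomialSum : ℕ → ℕ → PS
  binomialSum M K m = sum (map (binomialWeight M) (partitionsInto (positivePowers 2 K) m))

  binomialSum≗partialProduct : ∀ M K → K < M → binomialSum M K ≗ partialProduct d (suc K)
  binomialSum≗partialProduct M zero 0<M m = begin
      binomialWeight M (replicate m 1) + 0
    ≡⟨ +-identityʳ _ ⟩
      binomialWeight M (replicate m 1)
    ≡⟨ binomialWeight-ones M m 0<M ⟩
      nColours d 0 C m
    ≡⟨ sym (dilate-1 (nColours d 0 C_) m) ⟩
      dilated⊛ (nColours d 0 C_) 1 oneS m
    ≡⟨ sym (binomial (nColours d 0) 1 oneS ≤-refl m) ⟩
      (factor d 0 ⊛ oneS) m
    ≡⟨ ⊛-identityʳ (factor d 0) m ⟩
      factor d 0 m
    ≡⟨ sym (⊛-identityˡ (factor d 0) m) ⟩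
      partialProduct d 1 m
    ∎ where open ≡-Reasoning
  binomialSum≗partialProduct M (suc K) K<M m = begin
      binomialSum M (suc K) m
    ≡⟨ partitionsInto-∑ (2 ^ suc K) (positivePowers 2 K) m (binomialWeight M) (nColours d (suc K) C_) extract ⟩
      dilated⊛ (nColours d (suc K) C_) (2 ^ suc K) (binomialSum M K) m
    ≡⟨ sym (binomial (nColours d (suc K)) (2 ^ suc K) (binomialSum M K) (m^n>0 2 (suc K)) m) ⟩
      (factor d (suc K) ⊛ binomialSum M K) m
    ≡⟨ ⊛-cong (≗-refl {factor d (suc K)}) (binomialSum≗partialProduct M K (<-trans (n<1+n K) K<M)) m ⟩
      (factor d (suc K) ⊛ partialProduct d (suc K)) m
    ≡⟨ ⊛-comm (factor d (suc K)) (partialProduct d (suc K)) m ⟩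
      partialProduct d (suc (suc K)) m
    ∎
    where
    open ≡-Reasoning
    extract : ∀ e m′ μ → μ ∈ partitionsInto (positivePowers 2 K) m′ →
              binomialWeight M (replicate e (2 ^ suc K) ++ μ) ≡ (nColours d (suc K) C e) * binomialWeight M μ
    extract e m′ μ μ∈ = binomialWeight-replicate-++ M K e μ K<M
      (All.map (ValidParts-below (positivePowers-valid 2 (suc K) ≤-refl))
        (proj₁ (proj₂ (partitionsInto-sound (positivePowers 2 K) m′ μ (positivePowers-valid 2 K ≤-refl) μ∈))))

  binomProd-sum : ∀ n (G : Enumeration (B n)) → sum (map (binomProd d n) (elems G)) ≡ partialProduct d (suc n) n
  binomProd-sum n G = begin
      sum (map (binomProd d n) (elems G))
    ≡⟨ Enumeration-sum (binomProd d n) G (D-ary-enumeration 2 n n ≤-refl ≤-refl) ⟩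
      sum (map (binomProd d n) (partitionsInto (positivePowers 2 n) n))
    ≡⟨ cong sum (map-cong (λ λ′ → cong (foldr _*_ 1) (map-applyUpTo id (λ i → nColours d i C mult (2 ^ i) λ′) (suc n)))
                          (partitionsInto (positivePowers 2 n) n)) ⟩
      binomialSum (suc n) n n
    ≡⟨ binomialSum≗partialProduct (suc n) n (n<1+n n) n ⟩
      partialProduct d (suc n) n
    ∎ where open ≡-Reasoning

theorem4p4 : (d : ℕ) → .{{_ : NonZero d}} →
  -- (a) coefficientwise: the coefficient of q^n in the infinite product is the
  --     stable value of the partial products over i < N for all N > n
  ((n N : ℕ) → n < N → (E : Enumeration (ImP₂ n (2 ^ d))) →
    sum (map (mult 1) (elems E)) ≡ partialRHS d N n)
  -- (b) a_{n+2}(2^d) = Q_n(2^d)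
  × ((n : ℕ) → (E : Enumeration (ImP₂ (n + 2) (2 ^ d))) → (F : Enumeration (Q d n)) →
    sum (map (mult 1) (elems E)) ≡ length (elems F))
  -- (c) a_{n+2}(2^d) = Σ_{λ ∈ B(n)} ∏_i binom(⌊i/d⌋+3, m_{2^i}(λ))
  × ((n : ℕ) → (E : Enumeration (ImP₂ (n + 2) (2 ^ d))) → (G : Enumeration (B n)) →
    sum (map (mult 1) (elems E)) ≡ sum (map (binomProd d n) (elems G)))
theorem4p4 d = coefficients , (λ n E F → trans (a[n+2] n E) (sym (Q-count d n F)))
                             , (λ n E G → trans (a[n+2] n E) (sym (binomProd-sum d n G)))
  where
  open ≡-Reasoning
  D : ℕ
  D = 2 ^ d
  2≤D : 2 ≤ D
  2≤D = ^-monoʳ-≤ 2 (>-nonZero⁻¹ d)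
  coefficients : ∀ n N → n < N → (E : Enumeration (ImP₂ n D)) → sum (map (mult 1) (elems E)) ≡ partialRHS d N n
  coefficients n N n<N E = begin
      sum (map (mult 1) (elems E))
    ≡⟨ ones-ImP₂ D 2≤D n N (<⇒≤ n<N) E ⟩
      onesSum D 2≤D N n
    ≡⟨ onesSum≗onesGF D 2≤D N n ⟩
      onesGF D N n
    ≡⟨ onesGF-partialRHS d n N n<N ⟩
      partialRHS d N n
    ∎
  a[n+2] : ∀ n (E : Enumeration (ImP₂ (n + 2) D)) → sum (map (mult 1) (elems E)) ≡ partialProduct d (suc n) n
  a[n+2] n E = begin
      sum (map (mult 1) (elems E))
    ≡⟨ coefficients (n + 2) (suc n + 2) (n<1+n (n + 2)) E ⟩
      partialRHS d (suc n + 2) (n + 2)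
    ≡⟨ partialRHS-shift d n (suc n + 2) ⟩
      partialProduct d (suc n + 2) n
    ≡⟨ partialProduct-stable d n (suc n) 2 (n<1+n n) ⟩
      partialProduct d (suc n) n
    ∎
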